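{- Let $q$ be a prime power and $f_1,\dots,f_r\in\mathbb{F}_q[x_1,\dots,x_n]$ with $d=\sum_{i=1}^r\deg f_i$. Assume $n>d$ and that the common zero set $Z(\mathbf{f},\mathbb{F}_q^n)$ of $f_1,\dots,f_r$ in $\mathbb{F}_q^n$ is nonempty. If $Z(\mathbf{f},\mathbb{F}_q^n)$ is not an affine space of $\mathbb{F}_q^n$, then $Z(\mathbf{f},\mathbb{F}_q^n)$ contains at least $n+2-d$ points in general position.
   Context: An affine space in $\mathbb{F}_q^n$ is a coset of an $\mathbb{F}_q$-linear subspace; its dimension is that of the subspace. A set of points in $\mathbb{K}^t$ ($\mathbb{K}$ a field) is in general position if for no $m$ with $2\le m\le t+1$ do some $m$ of the points lie in an affine space of dimension $m-2$. (Here points of $\mathbb{F}_q^n$ are considered in $\mathbb{K}^t=\mathbb{F}_q^n$.) -}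

module Defs where

open import Level using (Level) renaming (suc to lsuc)
open import Algebra.Bundles using (CommutativeRing)
open import Data.Nat using (ℕ; zero; suc; _≤_; _<_; _^_)
open import Data.Nat as ℕ using ()
open import Data.Nat.Primality using (Prime)
open import Data.Fin using (Fin; zero; suc)
open import Data.Vec using (Vec; []; _∷_)
open import Data.List using (List; []; _∷_; map)
open import Data.List.Relation.Unary.All using (All)
open import Data.List.Relation.Unary.Unique.Propositional using (Unique)
open import Data.Product using (Σ; ∃; _×_; _,_; proj₁; proj₂)
open import Function.Definitions using (Injective)
open import Relation.Binary.PropositionalEquality using (_≡_)
open import Relation.Nullary using (¬_)

IsPrimePower : ℕ → Set
IsPrimePower q = Σ ℕ λ p → Σ ℕ λ k → Prime p × 1 ≤ k × q ≡ p ^ k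

record Field c ℓ : Set (lsuc (c Level.⊔ ℓ)) where
  field
    commutativeRing : CommutativeRing c ℓ
  open CommutativeRing commutativeRing public
  field
    0≉1     : ¬ (0# ≈ 1#)
    inverse : ∀ x → ¬ (x ≈ 0#) → Σ Carrier λ y → x * y ≈ 1#

module FieldTheory {c ℓ} (F : Field c ℓ) where
  open Field F using (Carrier; _≈_; _+_; _*_; 0#; 1#)

  HasCardinality : ℕ → Set (c Level.⊔ ℓ)
  HasCardinality q = Σ (Fin q → Carrier) λ e →
    (∀ i j → e i ≈ e j → i ≡ j) × (∀ x → Σ (Fin q) λ i → e i ≈ x)

  Point : ℕ → Set c
  Point n = Fin n → Carrier

  pow : Carrier → ℕ → Carrier
  pow x zero    = 1#
  pow x (suc k) = x * pow x k

  monomial : ∀ {n} → Vec ℕ n → Point n → Carrier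
  monomial []       x = 1#
  monomial (e ∷ es) x = pow (x zero) e * monomial es (λ i → x (suc i))

  totalDegree : ∀ {n} → Vec ℕ n → ℕ
  totalDegree []       = 0
  totalDegree (e ∷ es) = e ℕ.+ totalDegree es

  record Poly (n : ℕ) : Set (c Level.⊔ ℓ) where
    field
      terms    : List (Carrier × Vec ℕ n)
      distinct : Unique (map proj₂ terms)
      nonzero  : All (λ t → ¬ (proj₁ t ≈ 0#)) terms

  evalTerms : ∀ {n} → List (Carrier × Vec ℕ n) → Point n → Carrier
  evalTerms []             x = 0#
  evalTerms ((a , e) ∷ ts) x = a * monomial e x + evalTerms ts x

  eval : ∀ {n} → Poly n → Point n → Carrier
  eval f x = evalTerms (Poly.terms f) x

  degTerms : ∀ {n} → List (Carrier × Vec ℕ n) → ℕ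
  degTerms []             = 0
  degTerms ((a , e) ∷ ts) = totalDegree e ℕ.⊔ degTerms ts

  -- total degree (the zero polynomial gets degree 0)
  deg : ∀ {n} → Poly n → ℕ
  deg f = degTerms (Poly.terms f)

  Z : ∀ {n} → List (Poly n) → Point n → Set (c Level.⊔ ℓ)
  Z fs x = All (λ f → eval f x ≈ 0#) fs

  sumF : ∀ k → (Fin k → Carrier) → Carrier
  sumF zero    g = 0#
  sumF (suc k) g = g zero + sumF k (λ j → g (suc j))

  lin : ∀ {n k} → (Fin k → Carrier) → (Fin k → Point n) → Point n
  lin {k = k} cs vs i = sumF k (λ j → cs j * vs j i)

  LinearlyIndependent : ∀ {n k} → (Fin k → Point n) → Set (c Level.⊔ ℓ)
  LinearlyIndependent {k = k} vs =
    ∀ (cs : Fin k → Carrier) → (∀ i → lin cs vs i ≈ 0#) → ∀ j → cs j ≈ 0#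

  InAffine : ∀ {n k} → Point n → (Fin k → Point n) → Point n → Set (c Level.⊔ ℓ)
  InAffine {k = k} a vs x = Σ (Fin k → Carrier) λ cs → ∀ i → x i ≈ a i + lin cs vs i

  IsAffineSpace : ∀ {n p} → (Point n → Set p) → Set (c Level.⊔ ℓ Level.⊔ p)
  IsAffineSpace {n} S = Σ ℕ λ k → Σ (Point n) λ a → Σ (Fin k → Point n) λ vs →
    LinearlyIndependent vs ×
    (∀ x → (S x → InAffine a vs x) × (InAffine a vs x → S x))

  -- the points pts are in general position in F^n: for no m = k + 2 with
  -- 2 ≤ m ≤ n + 1 (i.e. k < n) do some m of them (distinct indices) lie in
  -- an affine space of dimension m - 2 = k.
  GeneralPosition : ∀ {n N} → (Fin N → Point n) → Set (c Level.⊔ ℓ)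
  GeneralPosition {n} {N} pts =
    ∀ k → k < n → (ι : Fin (2 ℕ.+ k) → Fin N) → Injective _≡_ _≡_ ι →
      ¬ (Σ (Point n) λ a → Σ (Fin k → Point n) λ vs →
           LinearlyIndependent vs × (∀ j → InAffine a vs (pts (ι j))))

-- Over 𝔽_q with Q = q − 1, Σ_{x ∈ 𝔽_q} x ^ k = 0 for k < Q, so a polynomial function on 𝔽_q^m of degree
-- below mQ sums to zero over 𝔽_q^m; in particular it is not the indicator function of a point. By Fermat,
-- χ₀ t = 1 − t ^ Q is the indicator of t = 0, and ∏_f χ₀ (f x) that of the zero set Z, of degree Qd.
--
-- Zeros P₀, P₁, … are chosen greedily, each outside the affine span A of the previous ones. While s + d ≤ n
-- (s = dim A) such a zero exists: otherwise Z ⊆ A, and as Z is not an affine space some b ∈ A misses Z.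
-- With σ pivot coordinates of A, ∏_f χ₀ (f x) · (∏ⱼ χ₀ (x_σⱼ − P₀_σⱼ) − ∏ⱼ χ₀ (x_σⱼ − b_σⱼ)) is then the
-- indicator of P₀, and as the leading terms of the two products cancel its degree is Qd + sQ − 1 < nQ.
-- This gives n + 2 − d affinely independent zeros. They are in general position: if k + 2 of them lay in
-- a k-dimensional affine space, the k + 1 equations expressing that would have only the trivial solution
-- in k + 2 unknowns, so the product of χ₀ over the equations would be a low-degree indicator of 0.

module Submission where

open import Defs
open import Level using (Level; _⊔_)
open import Algebra.Bundles using (CommutativeRing)
open import Algebra.Solver.Ring.AlmostCommutativeRing using (fromCommutativeRing; _-Raw-AlmostCommutative⟶_)
import Algebra.Solver.Ring
import Algebra.Properties.Ring
import Algebra.Properties.Semiring.Mult.TCOptimised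
import Algebra.Properties.CommutativeSemigroup
import Algebra.Properties.CommutativeMonoid.Sum
open import Data.Empty using (⊥-elim)
open import Data.Fin as Fin using (Fin; zero; suc)
import Data.Fin.Properties as Fin
open import Data.Fin.Permutation using (Permutation; permutation; _⟨$⟩ʳ_)
open import Data.Integer as ℤ using (ℤ; +_; -[1+_])
import Data.Integer.Properties as ℤ
open import Data.List using (List; []; _∷_; _++_; map)
open import Data.List.Relation.Unary.All as All using (All; []; _∷_)
import Data.List.Relation.Unary.All.Properties as All
open import Data.Maybe using (Maybe; just; nothing)
open import Data.Nat as ℕ using (ℕ; zero; suc; _≤_; _<_)
open import Data.Nat.ListAction using (sum)
import Data.Nat.Properties as ℕ
import Data.Nat.Solver
open import Data.Product using (Σ; _×_; _,_; proj₁; proj₂)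
open import Data.Sign as Sign using (Sign)
open import Data.Sum using (_⊎_; inj₁; inj₂)
open import Data.Vec as Vec using (Vec; []; _∷_)
open import Function using (_∘_; id)
open import Function.Definitions using (Injective)
open import Relation.Binary.Definitions using (Decidable)
open import Relation.Binary.PropositionalEquality as ≡ using (_≡_; _≢_)
import Relation.Binary.Reasoning.Setoid
open import Relation.Nullary using (¬_; Dec; yes; no)
open import Relation.Nullary.Decidable using (¬?; _×-dec_; decidable-stable)

-- Integer coefficients keep the solver's normal forms computable; a test for equality in the field would not.
module IntegerCoefficientSolver {c ℓ} (R : CommutativeRing c ℓ) where
  open CommutativeRing R
  open Algebra.Properties.Ring ring using (-1*x≈-x; -‿involutive; -0#≈0#; -‿+-comm)
  open Algebra.Properties.CommutativeSemigroup +-commutativeSemigroup using (interchange)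
  open Algebra.Properties.CommutativeSemigroup *-commutativeSemigroup using () renaming (interchange to interchange-*)
  open Algebra.Properties.Semiring.Mult.TCOptimised semiring using (×-homo-+; ×1-homo-*) renaming (_×_ to _·_)
  open Relation.Binary.Reasoning.Setoid setoid

  fromℤ : ℤ → Carrier
  fromℤ (+ n)    = n · 1#
  fromℤ -[1+ n ] = - (suc n · 1#)

  fromℤ-homo-⊖ : ∀ m n → fromℤ (m ℤ.⊖ n) ≈ m · 1# - n · 1#
  fromℤ-homo-⊖ m zero = begin
    fromℤ (m ℤ.⊖ 0) ≡⟨ ≡.cong fromℤ (ℤ.⊖-≥ {m} ℕ.z≤n) ⟩
    m · 1#          ≈⟨ sym (+-identityʳ _) ⟩
    m · 1# + 0#     ≈⟨ +-congˡ (sym -0#≈0#) ⟩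
    m · 1# - 0#     ∎
  fromℤ-homo-⊖ zero (suc n) = begin
    fromℤ (0 ℤ.⊖ suc n) ≡⟨ ≡.cong fromℤ (ℤ.⊖-< {0} {suc n} ℕ.z<s) ⟩
    - (suc n · 1#)      ≈⟨ sym (+-identityˡ _) ⟩
    0# - suc n · 1#     ∎
  fromℤ-homo-⊖ (suc m) (suc n) = begin
    fromℤ (suc m ℤ.⊖ suc n)               ≡⟨ ≡.cong fromℤ (ℤ.[1+m]⊖[1+n]≡m⊖n m n) ⟩
    fromℤ (m ℤ.⊖ n)                       ≈⟨ fromℤ-homo-⊖ m n ⟩
    m · 1# - n · 1#                       ≈⟨ +-identityˡ _ ⟨
    0# + (m · 1# - n · 1#)                ≈⟨ +-congʳ (-‿inverseʳ 1#) ⟨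
    (1# - 1#) + (m · 1# - n · 1#)         ≈⟨ interchange 1# (- 1#) (m · 1#) (- (n · 1#)) ⟩
    (1# + m · 1#) + (- 1# - n · 1#)       ≈⟨ +-congˡ (-‿+-comm 1# (n · 1#)) ⟩
    (1# + m · 1#) - (1# + n · 1#)         ≈⟨ +-cong (×-homo-+ 1# 1 m) (-‿cong (×-homo-+ 1# 1 n)) ⟨
    suc m · 1# - suc n · 1#               ∎

  fromℤ-homo-+ : ∀ i j → fromℤ (i ℤ.+ j) ≈ fromℤ i + fromℤ j
  fromℤ-homo-+ (+ m)    (+ n)    = ×-homo-+ 1# m n
  fromℤ-homo-+ (+ m)    -[1+ n ] = fromℤ-homo-⊖ m (suc n)
  fromℤ-homo-+ -[1+ m ] (+ n)    = trans (fromℤ-homo-⊖ n (suc m)) (+-comm _ _)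
  fromℤ-homo-+ -[1+ m ] -[1+ n ] = begin
    - (suc (suc (m ℕ.+ n)) · 1#)        ≡⟨ ≡.cong (λ k → - (suc k · 1#)) (ℕ.+-suc m n) ⟨
    - ((suc m ℕ.+ suc n) · 1#)          ≈⟨ -‿cong (×-homo-+ 1# (suc m) (suc n)) ⟩
    - (suc m · 1# + suc n · 1#)         ≈⟨ -‿+-comm _ _ ⟨
    - (suc m · 1#) - suc n · 1#         ∎

  fromℤ-homo-neg : ∀ i → fromℤ (ℤ.- i) ≈ - fromℤ i
  fromℤ-homo-neg -[1+ n ]    = sym (-‿involutive _)
  fromℤ-homo-neg (+ zero)    = sym -0#≈0#
  fromℤ-homo-neg (+ suc n)   = refl

  fromSign : Sign → Carrier
  fromSign Sign.+ = 1#
  fromSign Sign.- = - 1#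

  fromSign-homo-* : ∀ s t → fromSign (s Sign.* t) ≈ fromSign s * fromSign t
  fromSign-homo-* Sign.+ t      = sym (*-identityˡ _)
  fromSign-homo-* Sign.- Sign.+ = sym (*-identityʳ _)
  fromSign-homo-* Sign.- Sign.- = sym (trans (-1*x≈-x (- 1#)) (-‿involutive 1#))

  fromℤ-◃ : ∀ s n → fromℤ (s ℤ.◃ n) ≈ fromSign s * n · 1#
  fromℤ-◃ s       zero    = sym (zeroʳ _)
  fromℤ-◃ Sign.+ (suc n) = sym (*-identityˡ _)
  fromℤ-◃ Sign.- (suc n) = sym (-1*x≈-x _)

  fromℤ-sign-abs : ∀ i → fromℤ i ≈ fromSign (ℤ.sign i) * ℤ.∣ i ∣ · 1#
  fromℤ-sign-abs i = trans (reflexive (≡.cong fromℤ (≡.sym (ℤ.◃-inverse i)))) (fromℤ-◃ (ℤ.sign i) ℤ.∣ i ∣)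

  fromℤ-homo-* : ∀ i j → fromℤ (i ℤ.* j) ≈ fromℤ i * fromℤ j
  fromℤ-homo-* i j = begin
    fromℤ (s ℤ.◃ ∣i∣ ℕ.* ∣j∣)                     ≈⟨ fromℤ-◃ s (∣i∣ ℕ.* ∣j∣) ⟩
    fromSign s * (∣i∣ ℕ.* ∣j∣) · 1#               ≈⟨ *-cong (fromSign-homo-* (ℤ.sign i) (ℤ.sign j)) (×1-homo-* ∣i∣ ∣j∣) ⟩
    (fromSign (ℤ.sign i) * fromSign (ℤ.sign j)) * (∣i∣ · 1# * ∣j∣ · 1#)
      ≈⟨ interchange-* _ _ _ _ ⟩
    (fromSign (ℤ.sign i) * ∣i∣ · 1#) * (fromSign (ℤ.sign j) * ∣j∣ · 1#)
      ≈⟨ *-cong (fromℤ-sign-abs i) (fromℤ-sign-abs j) ⟨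
    fromℤ i * fromℤ j                             ∎
    where
    s = ℤ.sign i Sign.* ℤ.sign j
    ∣i∣ = ℤ.∣ i ∣
    ∣j∣ = ℤ.∣ j ∣

  fromℤ-homomorphism : ℤ.+-*-rawRing -Raw-AlmostCommutative⟶ fromCommutativeRing R
  fromℤ-homomorphism = record
    { ⟦_⟧ = fromℤ ; +-homo = fromℤ-homo-+ ; *-homo = fromℤ-homo-* ; -‿homo = fromℤ-homo-neg
    ; 0-homo = refl ; 1-homo = refl }

  _≟ᶜ_ : ∀ i j → Maybe (fromℤ i ≈ fromℤ j)
  i ≟ᶜ j with i ℤ.≟ j
  ... | yes ≡.refl = just refl
  ... | no _       = nothing

  open Algebra.Solver.Ring ℤ.+-*-rawRing (fromCommutativeRing R) fromℤ-homomorphism _≟ᶜ_ public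

module FieldLemmas {c ℓ} (F : Field c ℓ) where
  open Field F public hiding (zero)
  open FieldTheory F public
  open IntegerCoefficientSolver commutativeRing public using (solve; _:=_; _:+_; _:*_; _:-_; :-_; con)
  open Relation.Binary.Reasoning.Setoid setoid public
  open import Algebra.Definitions _≈_ public using (Congruent₁)
  open Algebra.Properties.Ring ring using (-‿+-comm)
  private
    module Sum = Algebra.Properties.CommutativeMonoid.Sum +-commutativeMonoid
    module Prod = Algebra.Properties.CommutativeMonoid.Sum *-commutativeMonoid

  1≉0 : 1# ≉ 0#
  1≉0 p = 0≉1 (sym p)

  x*y≈0⇒y≈0 : ∀ {x y} → x ≉ 0# → x * y ≈ 0# → y ≈ 0#
  x*y≈0⇒y≈0 {x} {y} x≉0 xy≈0 = begin
    y              ≈⟨ *-identityˡ y ⟨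
    1# * y         ≈⟨ *-congʳ (trans (*-comm _ _) (proj₂ (inverse x x≉0))) ⟨
    (x⁻¹ * x) * y  ≈⟨ *-assoc _ _ _ ⟩
    x⁻¹ * (x * y)  ≈⟨ *-congˡ xy≈0 ⟩
    x⁻¹ * 0#       ≈⟨ zeroʳ _ ⟩
    0#             ∎
    where x⁻¹ = proj₁ (inverse x x≉0)

  *-≉0 : ∀ {x y} → x ≉ 0# → y ≉ 0# → x * y ≉ 0#
  *-≉0 x≉0 y≉0 xy≈0 = y≉0 (x*y≈0⇒y≈0 x≉0 xy≈0)

  x-y≈0⇒x≈y : ∀ {x y} → x - y ≈ 0# → x ≈ y
  x-y≈0⇒x≈y {x} {y} p = begin
    x            ≈⟨ solve 2 (λ x y → x := (x :- y) :+ y) refl x y ⟩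
    (x - y) + y  ≈⟨ +-congʳ p ⟩
    0# + y       ≈⟨ +-identityˡ y ⟩
    y            ∎

  x≈y⇒x-y≈0 : ∀ {x y} → x ≈ y → x - y ≈ 0#
  x≈y⇒x-y≈0 {y = y} p = trans (+-congʳ p) (-‿inverseʳ y)

  [a-1]*x≈0 : ∀ {a x} → x ≈ a * x → (a - 1#) * x ≈ 0#
  [a-1]*x≈0 {a} {x} x≈ax = begin
    (a - 1#) * x   ≈⟨ solve 2 (λ a x → (a :- con (+ 1)) :* x := a :* x :- x) refl a x ⟩
    a * x - x      ≈⟨ x≈y⇒x-y≈0 (sym x≈ax) ⟩
    0#             ∎

  x≈a*x⇒a≈1 : ∀ {a x} → x ≉ 0# → x ≈ a * x → a ≈ 1#
  x≈a*x⇒a≈1 x≉0 x≈ax = x-y≈0⇒x≈y (x*y≈0⇒y≈0 x≉0 (trans (*-comm _ _) ([a-1]*x≈0 x≈ax)))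

  x≈a*x⇒x≈0 : ∀ {a x} → a ≉ 1# → x ≈ a * x → x ≈ 0#
  x≈a*x⇒x≈0 a≉1 x≈ax = x*y≈0⇒y≈0 (a≉1 ∘ x-y≈0⇒x≈y) ([a-1]*x≈0 x≈ax)

  δ : ∀ {k} → Fin k → Fin k → Carrier
  δ zero    zero    = 1#
  δ zero    (suc _) = 0#
  δ (suc _) zero    = 0#
  δ (suc a) (suc b) = δ a b

  δ-refl : ∀ {k} (a : Fin k) → δ a a ≈ 1#
  δ-refl zero    = refl
  δ-refl (suc a) = δ-refl a

  δ-≢ : ∀ {k} (a b : Fin k) → a ≢ b → δ a b ≈ 0#
  δ-≢ zero    zero    a≢b = ⊥-elim (a≢b ≡.refl)
  δ-≢ zero    (suc b) a≢b = refl
  δ-≢ (suc a) zero    a≢b = refl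
  δ-≢ (suc a) (suc b) a≢b = δ-≢ a b (a≢b ∘ ≡.cong suc)

  sumF-cong : ∀ k {g h : Fin k → Carrier} → (∀ j → g j ≈ h j) → sumF k g ≈ sumF k h
  sumF-cong zero    p = refl
  sumF-cong (suc k) p = +-cong (p zero) (sumF-cong k (p ∘ suc))

  sumF-zero : ∀ k {g : Fin k → Carrier} → (∀ j → g j ≈ 0#) → sumF k g ≈ 0#
  sumF-zero zero    p = refl
  sumF-zero (suc k) p = trans (+-cong (p zero) (sumF-zero k (p ∘ suc))) (+-identityˡ 0#)

  sumF-+ : ∀ k (g h : Fin k → Carrier) → sumF k (λ j → g j + h j) ≈ sumF k g + sumF k h
  sumF-+ zero    g h = sym (+-identityˡ 0#)
  sumF-+ (suc k) g h = trans (+-congˡ (sumF-+ k (g ∘ suc) (h ∘ suc))) (interchange _ _ _ _)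
    where open Algebra.Properties.CommutativeSemigroup +-commutativeSemigroup using (interchange)

  sumF-*ˡ : ∀ k a (g : Fin k → Carrier) → sumF k (λ j → a * g j) ≈ a * sumF k g
  sumF-*ˡ zero    a g = sym (zeroʳ a)
  sumF-*ˡ (suc k) a g = trans (+-congˡ (sumF-*ˡ k a (g ∘ suc))) (sym (distribˡ a _ _))

  sumF-*ʳ : ∀ k a (g : Fin k → Carrier) → sumF k (λ j → g j * a) ≈ sumF k g * a
  sumF-*ʳ k a g = trans (sumF-cong k (λ j → *-comm (g j) a)) (trans (sumF-*ˡ k a g) (*-comm a _))

  sumF-neg : ∀ k (g : Fin k → Carrier) → sumF k (λ j → - g j) ≈ - sumF k g
  sumF-neg zero    g = sym -0#≈0#
    where open Algebra.Properties.Ring ring using (-0#≈0#)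
  sumF-neg (suc k) g = trans (+-congˡ (sumF-neg k (g ∘ suc))) (-‿+-comm _ _)

  sumF-- : ∀ k (g h : Fin k → Carrier) → sumF k (λ j → g j - h j) ≈ sumF k g - sumF k h
  sumF-- k g h = trans (sumF-+ k g (λ j → - h j)) (+-congˡ (sumF-neg k h))

  sumF-comm : ∀ k m (f : Fin k → Fin m → Carrier) →
    sumF k (λ i → sumF m (f i)) ≈ sumF m (λ j → sumF k (λ i → f i j))
  sumF-comm zero    m f = sym (sumF-zero m (λ j → refl))
  sumF-comm (suc k) m f = begin
    sumF m (f zero) + sumF k (λ i → sumF m (f (suc i)))           ≈⟨ +-congˡ (sumF-comm k m (f ∘ suc)) ⟩
    sumF m (f zero) + sumF m (λ j → sumF k (λ i → f (suc i) j))   ≈⟨ sumF-+ m _ _ ⟨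
    sumF m (λ j → f zero j + sumF k (λ i → f (suc i) j))          ∎

  sumF-single : ∀ k (g : Fin k → Carrier) i → (∀ j → j ≢ i → g j ≈ 0#) → sumF k g ≈ g i
  sumF-single (suc k) g zero    p = trans (+-congˡ (sumF-zero k (λ j → p (suc j) λ ()))) (+-identityʳ _)
  sumF-single (suc k) g (suc i) p = trans (+-congʳ (p zero λ ())) (trans (+-identityˡ _)
    (sumF-single k (g ∘ suc) i (λ j j≢i → p (suc j) (j≢i ∘ Fin.suc-injective))))

  sumF-δ : ∀ k (g : Fin k → Carrier) i → sumF k (λ j → δ i j * g j) ≈ g i
  sumF-δ k g i = trans (sumF-single k _ i (λ j j≢i → trans (*-congʳ (δ-≢ i j (j≢i ∘ ≡.sym))) (zeroˡ _)))
                       (trans (*-congʳ (δ-refl i)) (*-identityˡ _))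

  sumF-assoc : ∀ L J (a : Fin L → Carrier) (b : Fin L → Fin J → Carrier) (k : Fin J → Carrier) →
    sumF L (λ l → a l * sumF J (λ j → b l j * k j)) ≈ sumF J (λ j → sumF L (λ l → a l * b l j) * k j)
  sumF-assoc L J a b k = begin
    sumF L (λ l → a l * sumF J (λ j → b l j * k j))    ≈⟨ sumF-cong L (λ l → sumF-*ˡ J (a l) _) ⟨
    sumF L (λ l → sumF J (λ j → a l * (b l j * k j)))  ≈⟨ sumF-comm L J _ ⟩
    sumF J (λ j → sumF L (λ l → a l * (b l j * k j)))  ≈⟨ sumF-cong J (λ j → sumF-cong L (λ l → *-assoc _ _ _)) ⟨
    sumF J (λ j → sumF L (λ l → (a l * b l j) * k j))  ≈⟨ sumF-cong J (λ j → sumF-*ʳ L (k j) _) ⟩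
    sumF J (λ j → sumF L (λ l → a l * b l j) * k j)    ∎

  sumF≈sum : ∀ k (g : Fin k → Carrier) → sumF k g ≈ Sum.sum g
  sumF≈sum zero    g = refl
  sumF≈sum (suc k) g = +-congˡ (sumF≈sum k (g ∘ suc))

  sumF-permute : ∀ {k} (g : Fin k → Carrier) (π : Permutation k k) → sumF k g ≈ sumF k (g ∘ (π ⟨$⟩ʳ_))
  sumF-permute {k} g π =
    trans (sumF≈sum k g) (trans (Sum.sum-permute g π) (sym (sumF≈sum k (g ∘ (π ⟨$⟩ʳ_)))))

  lin-cong : ∀ {m k} {cs cs' : Fin k → Carrier} (vs : Fin k → Point m) →
    (∀ j → cs j ≈ cs' j) → ∀ i → lin cs vs i ≈ lin cs' vs i
  lin-cong {k = k} vs p i = sumF-cong k (λ j → *-congʳ (p j))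

  lin-zero : ∀ {m k} {cs : Fin k → Carrier} (vs : Fin k → Point m) → (∀ j → cs j ≈ 0#) → ∀ i → lin cs vs i ≈ 0#
  lin-zero {k = k} vs cs≈0 i = sumF-zero k (λ j → trans (*-congʳ (cs≈0 j)) (zeroˡ _))

  lin-+ : ∀ {m k} (cs ds : Fin k → Carrier) (vs : Fin k → Point m) i →
    lin (λ j → cs j + ds j) vs i ≈ lin cs vs i + lin ds vs i
  lin-+ {k = k} cs ds vs i = trans (sumF-cong k (λ j → distribʳ _ _ _)) (sumF-+ k _ _)

  lin-*ˡ : ∀ {m k} a (cs : Fin k → Carrier) (vs : Fin k → Point m) i →
    lin (λ j → a * cs j) vs i ≈ a * lin cs vs i
  lin-*ˡ {k = k} a cs vs i = trans (sumF-cong k (λ j → *-assoc _ _ _)) (sumF-*ˡ k a _)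

  lin-assoc : ∀ {m k l} (cs : Fin l → Carrier) (ws : Fin l → Point k) (vs : Fin k → Point m) i →
    sumF l (λ j → cs j * lin (ws j) vs i) ≈ lin (lin cs ws) vs i
  lin-assoc {k = k} {l} cs ws vs i = sumF-assoc l k cs ws (λ j → vs j i)

  prodF : ∀ k → (Fin k → Carrier) → Carrier
  prodF zero    g = 1#
  prodF (suc k) g = g zero * prodF k (g ∘ suc)

  prodF-cong : ∀ k {g h : Fin k → Carrier} → (∀ j → g j ≈ h j) → prodF k g ≈ prodF k h
  prodF-cong zero    p = refl
  prodF-cong (suc k) p = *-cong (p zero) (prodF-cong k (p ∘ suc))

  prodF-one : ∀ k {g : Fin k → Carrier} → (∀ j → g j ≈ 1#) → prodF k g ≈ 1#
  prodF-one zero    p = refl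
  prodF-one (suc k) p = trans (*-cong (p zero) (prodF-one k (p ∘ suc))) (*-identityˡ 1#)

  prodF-zero : ∀ k (g : Fin k → Carrier) i → g i ≈ 0# → prodF k g ≈ 0#
  prodF-zero (suc k) g zero    p = trans (*-congʳ p) (zeroˡ _)
  prodF-zero (suc k) g (suc i) p = trans (*-congˡ (prodF-zero k (g ∘ suc) i p)) (zeroʳ _)

  prodF-* : ∀ k (g h : Fin k → Carrier) → prodF k (λ j → g j * h j) ≈ prodF k g * prodF k h
  prodF-* zero    g h = sym (*-identityˡ 1#)
  prodF-* (suc k) g h = trans (*-congˡ (prodF-* k (g ∘ suc) (h ∘ suc))) (interchange _ _ _ _)
    where open Algebra.Properties.CommutativeSemigroup *-commutativeSemigroup using (interchange)

  prodF-single : ∀ k (g : Fin k → Carrier) i → (∀ j → j ≢ i → g j ≈ 1#) → prodF k g ≈ g i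
  prodF-single (suc k) g zero    p = trans (*-congˡ (prodF-one k (λ j → p (suc j) λ ()))) (*-identityʳ _)
  prodF-single (suc k) g (suc i) p = trans (*-congʳ (p zero λ ())) (trans (*-identityˡ _)
    (prodF-single k (g ∘ suc) i (λ j j≢i → p (suc j) (j≢i ∘ Fin.suc-injective))))

  prodF-≉0 : ∀ k (g : Fin k → Carrier) → (∀ j → g j ≉ 0#) → prodF k g ≉ 0#
  prodF-≉0 zero    g p = 1≉0
  prodF-≉0 (suc k) g p = *-≉0 (p zero) (prodF-≉0 k (g ∘ suc) (p ∘ suc))

  prodF-all-but-one : ∀ k (h : Fin (suc k) → Carrier) i a →
    h i ≈ 1# → (∀ j → j ≢ i → h j ≈ a) → prodF (suc k) h ≈ pow a k
  prodF-all-but-one zero    h zero    a hᵢ≈1 _ = trans (*-identityʳ _) hᵢ≈1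
  prodF-all-but-one (suc k) h zero    a hᵢ≈1 h≈a =
    trans (*-cong hᵢ≈1 (prodF-cong (suc k) (λ j → h≈a (suc j) λ ()))) (trans (*-identityˡ _) (prodF-const (suc k)))
    where
    prodF-const : ∀ k → prodF k (λ _ → a) ≈ pow a k
    prodF-const zero    = refl
    prodF-const (suc k) = *-congˡ (prodF-const k)
  prodF-all-but-one (suc k) h (suc i) a hᵢ≈1 h≈a =
    *-cong (h≈a zero λ ()) (prodF-all-but-one k (h ∘ suc) i a hᵢ≈1 (λ j j≢i → h≈a (suc j) (j≢i ∘ Fin.suc-injective)))

  prodF≈prod : ∀ k (g : Fin k → Carrier) → prodF k g ≈ Prod.sum g
  prodF≈prod zero    g = refl
  prodF≈prod (suc k) g = *-congˡ (prodF≈prod k (g ∘ suc))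

  prodF-permute : ∀ {k} (g : Fin k → Carrier) (π : Permutation k k) → prodF k g ≈ prodF k (g ∘ (π ⟨$⟩ʳ_))
  prodF-permute {k} g π =
    trans (prodF≈prod k g) (trans (Prod.sum-permute g π) (sym (prodF≈prod k (g ∘ (π ⟨$⟩ʳ_)))))

  pow-cong : ∀ {x y} k → x ≈ y → pow x k ≈ pow y k
  pow-cong zero    p = refl
  pow-cong (suc k) p = *-cong p (pow-cong k p)

  pow-+ : ∀ x a b → pow x (a ℕ.+ b) ≈ pow x a * pow x b
  pow-+ x zero    b = sym (*-identityˡ _)
  pow-+ x (suc a) b = trans (*-congˡ (pow-+ x a b)) (sym (*-assoc _ _ _))

  pow-* : ∀ x y k → pow (x * y) k ≈ pow x k * pow y k
  pow-* x y zero    = sym (*-identityˡ _)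
  pow-* x y (suc k) = trans (*-congˡ (pow-* x y k)) (interchange _ _ _ _)
    where open Algebra.Properties.CommutativeSemigroup *-commutativeSemigroup using (interchange)

  monic : ∀ k → (Fin k → Carrier) → Carrier → Carrier
  monic zero    cs x = 1#
  monic (suc k) cs x = x * monic k (cs ∘ suc) x + cs zero

  monic-quotient : ∀ k → (Fin (suc k) → Carrier) → Carrier → Fin k → Carrier
  monic-quotient (suc k) cs a zero    = monic (suc k) (cs ∘ suc) a
  monic-quotient (suc k) cs a (suc j) = monic-quotient k (cs ∘ suc) a j

  monic-division : ∀ k (cs : Fin (suc k) → Carrier) a x →
    monic (suc k) cs x ≈ (x - a) * monic k (monic-quotient k cs a) x + monic (suc k) cs a
  monic-division zero cs a x =
    solve 3 (λ x c a → x :* con (+ 1) :+ c := (x :- a) :* con (+ 1) :+ (a :* con (+ 1) :+ c)) refl x (cs zero) a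
  monic-division (suc k) cs a x = begin
    x * monic (suc k) r x + cs zero
      ≈⟨ +-congʳ (*-congˡ (monic-division k r a x)) ⟩
    x * ((x - a) * p + monic (suc k) r a) + cs zero
      ≈⟨ solve 5 (λ x a p ra c → x :* ((x :- a) :* p :+ ra) :+ c := (x :- a) :* (x :* p :+ ra) :+ (a :* ra :+ c))
           refl x a p (monic (suc k) r a) (cs zero) ⟩
    (x - a) * (x * p + monic (suc k) r a) + (a * monic (suc k) r a + cs zero) ∎
    where
    r = cs ∘ suc
    p = monic k (monic-quotient k r a) x

  monic-root-bound : ∀ k (cs : Fin k → Carrier) (as : Fin (suc k) → Carrier) →
    (∀ i j → i ≢ j → as i ≉ as j) → ¬ (∀ i → monic k cs (as i) ≈ 0#)
  monic-root-bound zero    cs as distinct roots = 1≉0 (roots zero)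
  monic-root-bound (suc k) cs as distinct roots =
    monic-root-bound k (monic-quotient k cs a₀) (as ∘ suc)
      (λ i j i≢j → distinct (suc i) (suc j) (i≢j ∘ Fin.suc-injective)) quotient-roots
    where
    a₀ = as zero
    quotient-roots : ∀ j → monic k (monic-quotient k cs a₀) (as (suc j)) ≈ 0#
    quotient-roots j = x*y≈0⇒y≈0 (λ d≈0 → distinct (suc j) zero (λ ()) (x-y≈0⇒x≈y d≈0)) (begin
      (as (suc j) - a₀) * monic k (monic-quotient k cs a₀) (as (suc j))
        ≈⟨ solve 2 (λ u v → u := u :+ v :- v) refl _ (monic (suc k) cs a₀) ⟩
      (as (suc j) - a₀) * monic k (monic-quotient k cs a₀) (as (suc j)) + monic (suc k) cs a₀ - monic (suc k) cs a₀
        ≈⟨ +-congʳ (monic-division k cs a₀ (as (suc j))) ⟨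
      monic (suc k) cs (as (suc j)) - monic (suc k) cs a₀
        ≈⟨ x≈y⇒x-y≈0 (trans (roots (suc j)) (sym (roots zero))) ⟩
      0# ∎)

  pow-minus-one : ∀ k → Fin (suc k) → Carrier
  pow-minus-one k zero    = - 1#
  pow-minus-one k (suc _) = 0#

  monic-pow-minus-one : ∀ k x → monic (suc k) (pow-minus-one k) x ≈ pow x (suc k) - 1#
  monic-pow-minus-one k x = +-congʳ (*-congˡ (monic-zero-coefficients k))
    where
    monic-zero-coefficients : ∀ k → monic k (λ _ → 0#) x ≈ pow x k
    monic-zero-coefficients zero    = refl
    monic-zero-coefficients (suc k) = trans (+-identityʳ _) (*-congˡ (monic-zero-coefficients k))

  pow≈1-root-bound : ∀ k (as : Fin (suc (suc k)) → Carrier) →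
    (∀ i j → i ≢ j → as i ≉ as j) → ¬ (∀ i → pow (as i) (suc k) ≈ 1#)
  pow≈1-root-bound k as distinct roots = monic-root-bound (suc k) (pow-minus-one k) as distinct
    (λ i → trans (monic-pow-minus-one k (as i)) (x≈y⇒x-y≈0 (roots i)))

  geometricSum : ℕ → Carrier → Carrier → Carrier
  geometricSum zero    x y = 1#
  geometricSum (suc k) x y = y * geometricSum k x y + pow x (suc k)

  pow-difference : ∀ k x y → pow y (suc k) - pow x (suc k) ≈ (y - x) * geometricSum k x y
  pow-difference zero x y =
    solve 2 (λ x y → y :* con (+ 1) :- x :* con (+ 1) := (y :- x) :* con (+ 1)) refl x y
  pow-difference (suc k) x y = begin
    y * pow y (suc k) - x * xᵏ⁺¹                         ≈⟨ +-congʳ (*-congˡ yᵏ⁺¹-expanded) ⟩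
    y * (xᵏ⁺¹ + (y - x) * geometricSum k x y) - x * xᵏ⁺¹
      ≈⟨ solve 4 (λ x y p G → y :* (p :+ (y :- x) :* G) :- x :* p := (y :- x) :* (y :* G :+ p)) refl x y xᵏ⁺¹ _ ⟩
    (y - x) * (y * geometricSum k x y + xᵏ⁺¹)              ∎
    where
    xᵏ⁺¹ = pow x (suc k)
    yᵏ⁺¹-expanded : pow y (suc k) ≈ xᵏ⁺¹ + (y - x) * geometricSum k x y
    yᵏ⁺¹-expanded = trans (solve 2 (λ a b → a := b :+ (a :- b)) refl (pow y (suc k)) xᵏ⁺¹)
                          (+-congˡ (pow-difference k x y))

-- The field has q = q₀ + 2 elements (a field has at least two); Q = q − 1 is the exponent in Fermat's little theorem.
module FiniteField {c ℓ} (F : Field c ℓ) (q₀ : ℕ) (card : FieldTheory.HasCardinality F (suc (suc q₀))) where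
  open FieldLemmas F public

  q Q : ℕ
  q = suc (suc q₀)
  Q = suc q₀

  enum : Fin q → Carrier
  enum = proj₁ card

  enum-injective : ∀ i j → enum i ≈ enum j → i ≡ j
  enum-injective = proj₁ (proj₂ card)

  index : Carrier → Fin q
  index x = proj₁ (proj₂ (proj₂ card) x)

  enum-index : ∀ x → enum (index x) ≈ x
  enum-index x = proj₂ (proj₂ (proj₂ card) x)

  _≈?_ : Decidable _≈_
  x ≈? y with index x Fin.≟ index y
  ... | yes eq = yes (trans (sym (enum-index x)) (trans (reflexive (≡.cong enum eq)) (enum-index y)))
  ... | no  ne = no (λ x≈y → ne (enum-injective _ _ (trans (enum-index x) (trans x≈y (sym (enum-index y))))))

  ΣF ΠF : (Carrier → Carrier) → Carrier
  ΣF g = sumF q (g ∘ enum)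
  ΠF g = prodF q (g ∘ enum)

  ΣF-cong : ∀ {g h} → (∀ x → g x ≈ h x) → ΣF g ≈ ΣF h
  ΣF-cong p = sumF-cong q (p ∘ enum)

  module Reindexing (f f⁻¹ : Carrier → Carrier) (f-cong : Congruent₁ f) (f⁻¹-cong : Congruent₁ f⁻¹)
                    (f∘f⁻¹ : ∀ x → f (f⁻¹ x) ≈ x) (f⁻¹∘f : ∀ x → f⁻¹ (f x) ≈ x) where
    π : Permutation q q
    π = permutation (index ∘ f ∘ enum) (index ∘ f⁻¹ ∘ enum)
      (λ i → enum-injective _ _ (trans (enum-index _) (trans (f-cong (enum-index _)) (f∘f⁻¹ (enum i)))))
      (λ i → enum-injective _ _ (trans (enum-index _) (trans (f⁻¹-cong (enum-index _)) (f⁻¹∘f (enum i)))))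

    ΣF-reindex : ∀ g → Congruent₁ g → ΣF g ≈ ΣF (g ∘ f)
    ΣF-reindex g g-cong = trans (sumF-permute (g ∘ enum) π) (sumF-cong q (λ i → g-cong (enum-index (f (enum i)))))

    ΠF-reindex : ∀ g → Congruent₁ g → ΠF g ≈ ΠF (g ∘ f)
    ΠF-reindex g g-cong = trans (prodF-permute (g ∘ enum) π) (prodF-cong q (λ i → g-cong (enum-index (f (enum i)))))

  module Scaling {a} (a≉0 : a ≉ 0#) where
    private
      a⁻¹ = proj₁ (inverse a a≉0)
      a*a⁻¹≈1 = proj₂ (inverse a a≉0)
    open Reindexing (a *_) (a⁻¹ *_) *-congˡ *-congˡ
      (λ x → trans (sym (*-assoc _ _ _)) (trans (*-congʳ a*a⁻¹≈1) (*-identityˡ x)))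
      (λ x → trans (sym (*-assoc _ _ _)) (trans (*-congʳ (trans (*-comm _ _) a*a⁻¹≈1)) (*-identityˡ x)))
      public

  ΣF-one : ΣF (λ _ → 1#) ≈ 0#
  ΣF-one = +-identityʳ-unique (ΣF id) (ΣF (λ _ → 1#)) (sym (begin
    ΣF id                     ≈⟨ ΣF-reindex id id ⟩
    ΣF (_+ 1#)                ≈⟨ sumF-+ q enum (λ _ → 1#) ⟩
    ΣF id + ΣF (λ _ → 1#)     ∎))
    where
    open Algebra.Properties.Ring ring using (+-identityʳ-unique)
    open Reindexing (_+ 1#) (_- 1#) +-congʳ +-congʳ
      (λ x → solve 2 (λ x o → (x :- o) :+ o := x) refl x 1#)
      (λ x → solve 2 (λ x o → (x :+ o) :- o := x) refl x 1#)

  fermat : ∀ {a} → a ≉ 0# → pow a Q ≈ 1#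
  fermat {a} a≉0 = x≈a*x⇒a≈1 (prodF-≉0 q _ (λ i → zero↦one-≉0 (enum i))) (begin
    ΠF zero↦one                                  ≈⟨ ΠF-reindex zero↦one zero↦one-cong ⟩
    ΠF (λ x → zero↦one (a * x))                  ≈⟨ prodF-cong q (λ i → zero↦one-scale (enum i)) ⟩
    ΠF (λ x → factor x * zero↦one x)             ≈⟨ prodF-* q (factor ∘ enum) (zero↦one ∘ enum) ⟩
    ΠF factor * ΠF zero↦one                      ≈⟨ *-congʳ ΠF-factor ⟩
    pow a Q * ΠF zero↦one                        ∎)
    where
    open Scaling a≉0
    zero↦one factor : Carrier → Carrier
    zero↦one y with y ≈? 0#
    ... | yes _ = 1#
    ... | no  _ = y
    factor y with y ≈? 0#
    ... | yes _ = 1#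
    ... | no  _ = a

    zero↦one-≉0 : ∀ y → zero↦one y ≉ 0#
    zero↦one-≉0 y with y ≈? 0#
    ... | yes _   = 1≉0
    ... | no  y≉0 = y≉0

    zero↦one-cong : Congruent₁ zero↦one
    zero↦one-cong {x} {y} x≈y with x ≈? 0# | y ≈? 0#
    ... | yes _   | yes _   = refl
    ... | yes x≈0 | no  y≉0 = ⊥-elim (y≉0 (trans (sym x≈y) x≈0))
    ... | no  x≉0 | yes y≈0 = ⊥-elim (x≉0 (trans x≈y y≈0))
    ... | no  _   | no  _   = x≈y

    zero↦one-scale : ∀ y → zero↦one (a * y) ≈ factor y * zero↦one y
    zero↦one-scale y with y ≈? 0# | (a * y) ≈? 0#
    ... | yes _   | yes _    = sym (*-identityˡ _)
    ... | yes y≈0 | no  ay≉0 = ⊥-elim (ay≉0 (trans (*-congˡ y≈0) (zeroʳ a)))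
    ... | no  y≉0 | yes ay≈0 = ⊥-elim (y≉0 (x*y≈0⇒y≈0 a≉0 ay≈0))
    ... | no  _   | no  _    = refl

    ΠF-factor : ΠF factor ≈ pow a Q
    ΠF-factor = prodF-all-but-one Q (factor ∘ enum) (index 0#) a factor-0 factor-≉0
      where
      factor-0 : factor (enum (index 0#)) ≈ 1#
      factor-0 with enum (index 0#) ≈? 0#
      ... | yes _ = refl
      ... | no ≉0 = ⊥-elim (≉0 (enum-index 0#))
      factor-≉0 : ∀ j → j ≢ index 0# → factor (enum j) ≈ a
      factor-≉0 j j≢0 with enum j ≈? 0#
      ... | yes ≈0 = ⊥-elim (j≢0 (enum-injective _ _ (trans ≈0 (sym (enum-index 0#)))))
      ... | no  _  = refl

  nonzero-non-root : ∀ k → suc k < Q → Σ Carrier λ a → a ≉ 0# × pow a (suc k) ≉ 1#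
  nonzero-non-root k k+1<Q with Fin.any? (λ i → ¬? (enum i ≈? 0#) ×-dec ¬? (pow (enum i) (suc k) ≈? 1#))
  ... | yes (i , ≉0 , ≉1) = enum i , ≉0 , ≉1
  ... | no  none          = ⊥-elim (pow≈1-root-bound k as distinct roots)
    where
    -- k + 2 ≤ Q distinct nonzero elements of the field
    ix : Fin (suc (suc k)) → Fin q
    ix j = Fin.punchIn (index 0#) (Fin.inject≤ j k+1<Q)
    as : Fin (suc (suc k)) → Carrier
    as = enum ∘ ix
    distinct : ∀ i j → i ≢ j → as i ≉ as j
    distinct i j i≢j asᵢ≈asⱼ = i≢j (Fin.inject≤-injective k+1<Q k+1<Q i j
      (Fin.punchIn-injective (index 0#) _ _ (enum-injective _ _ asᵢ≈asⱼ)))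
    nonzero : ∀ j → as j ≉ 0#
    nonzero j asⱼ≈0 = Fin.punchInᵢ≢i (index 0#) (Fin.inject≤ j k+1<Q)
      (enum-injective _ _ (trans asⱼ≈0 (sym (enum-index 0#))))
    roots : ∀ j → pow (as j) (suc k) ≈ 1#
    roots j with pow (as j) (suc k) ≈? 1#
    ... | yes ≈1 = ≈1
    ... | no  ≉1 = ⊥-elim (none (ix j , nonzero j , ≉1))

  ΣF-pow : ∀ k → k < Q → ΣF (λ x → pow x k) ≈ 0#
  ΣF-pow zero    _     = ΣF-one
  ΣF-pow (suc k) k+1<Q with nonzero-non-root k k+1<Q
  ... | a , a≉0 , aᵏ⁺¹≉1 = x≈a*x⇒x≈0 aᵏ⁺¹≉1 (begin
    ΣF (λ x → pow x (suc k))                     ≈⟨ ΣF-reindex (λ x → pow x (suc k)) (pow-cong (suc k)) ⟩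
    ΣF (λ x → pow (a * x) (suc k))               ≈⟨ ΣF-cong (λ x → pow-* a x (suc k)) ⟩
    ΣF (λ x → pow a (suc k) * pow x (suc k))     ≈⟨ sumF-*ˡ q (pow a (suc k)) (λ i → pow (enum i) (suc k)) ⟩
    pow a (suc k) * ΣF (λ x → pow x (suc k))     ∎)
    where open Scaling a≉0

  χ₀ : Carrier → Carrier
  χ₀ t = 1# - pow t Q

  χ₀-zero : ∀ {t} → t ≈ 0# → χ₀ t ≈ 1#
  χ₀-zero {t} t≈0 = begin
    1# - pow t Q    ≈⟨ +-congˡ (-‿cong (pow-cong Q t≈0)) ⟩
    1# - 0# * _     ≈⟨ solve 2 (λ o x → o :- con (+ 0) :* x := o) refl 1# _ ⟩
    1#              ∎

  χ₀-nonzero : ∀ {t} → t ≉ 0# → χ₀ t ≈ 0#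
  χ₀-nonzero t≉0 = x≈y⇒x-y≈0 (sym (fermat t≉0))

  searchCarrier : ∀ {p} (P : Carrier → Set p) → (∀ {x y} → x ≈ y → P x → P y) → (∀ x → Dec (P x)) →
    Σ Carrier P ⊎ (∀ x → ¬ P x)
  searchCarrier P P-resp P? with Fin.any? (P? ∘ enum)
  ... | yes (i , p) = inj₁ (enum i , p)
  ... | no  none    = inj₂ (λ x px → none (index x , P-resp (sym (enum-index x)) px))

module FiniteSpace {c ℓ} (F : Field c ℓ) (q₀ : ℕ) (card : FieldTheory.HasCardinality F (suc (suc q₀))) where
  open FiniteField F q₀ card public

  _◂_ : ∀ {m} → Carrier → Point m → Point (suc m)
  (x ◂ y) zero    = x
  (x ◂ y) (suc i) = y i

  infix 4 _≋_
  _≋_ : ∀ {m} → Point m → Point m → Set ℓ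
  x ≋ y = ∀ i → x i ≈ y i

  PointCongruent : ∀ {m} → (Point m → Carrier) → Set (c ⊔ ℓ)
  PointCongruent g = ∀ {x y} → x ≋ y → g x ≈ g y

  ΣP : ∀ m → (Point m → Carrier) → Carrier
  ΣP zero    g = g (λ ())
  ΣP (suc m) g = ΣF (λ x → ΣP m (λ y → g (x ◂ y)))

  ΣP-cong : ∀ m {g h : Point m → Carrier} → (∀ x → g x ≈ h x) → ΣP m g ≈ ΣP m h
  ΣP-cong zero    p = p _
  ΣP-cong (suc m) p = ΣF-cong (λ x → ΣP-cong m (λ y → p (x ◂ y)))

  ΣP-zero : ∀ m {g : Point m → Carrier} → (∀ x → g x ≈ 0#) → ΣP m g ≈ 0#
  ΣP-zero zero    p = p _
  ΣP-zero (suc m) p = sumF-zero q (λ i → ΣP-zero m (λ y → p (enum i ◂ y)))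

  ΣP-+ : ∀ m (g h : Point m → Carrier) → ΣP m (λ x → g x + h x) ≈ ΣP m g + ΣP m h
  ΣP-+ zero    g h = refl
  ΣP-+ (suc m) g h = trans (ΣF-cong (λ x → ΣP-+ m (λ y → g (x ◂ y)) (λ y → h (x ◂ y))))
                           (sumF-+ q (λ i → ΣP m (λ y → g (enum i ◂ y))) (λ i → ΣP m (λ y → h (enum i ◂ y))))

  ΣP-*ˡ : ∀ m a (g : Point m → Carrier) → ΣP m (λ x → a * g x) ≈ a * ΣP m g
  ΣP-*ˡ zero    a g = refl
  ΣP-*ˡ (suc m) a g = trans (ΣF-cong (λ x → ΣP-*ˡ m a (λ y → g (x ◂ y))))
                            (sumF-*ˡ q a (λ i → ΣP m (λ y → g (enum i ◂ y))))

  ΣP-single : ∀ m (g : Point m → Carrier) → PointCongruent g → (p : Point m) →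
    (∀ x → ¬ x ≋ p → g x ≈ 0#) → ΣP m g ≈ g p
  ΣP-single zero    g g-cong p g≈0 = g-cong (λ ())
  ΣP-single (suc m) g g-cong p g≈0 = begin
    ΣF slice                         ≈⟨ sumF-single q (slice ∘ enum) i₀ slice≈0 ⟩
    slice (enum i₀)                  ≈⟨ ΣP-single m (λ y → g (enum i₀ ◂ y)) (λ y≋y' → g-cong (◂-cong refl y≋y')) (p ∘ suc)
                                          (λ y y≉ → g≈0 _ (λ x≋p → y≉ (x≋p ∘ suc))) ⟩
    g (enum i₀ ◂ (p ∘ suc))          ≈⟨ g-cong (λ { zero → enum-index (p zero) ; (suc i) → refl }) ⟩
    g p                              ∎
    where
    i₀ = index (p zero)
    ◂-cong : ∀ {x x' y y'} → x ≈ x' → y ≋ y' → (x ◂ y) ≋ (x' ◂ y')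
    ◂-cong x≈x' y≋y' zero    = x≈x'
    ◂-cong x≈x' y≋y' (suc i) = y≋y' i
    slice : Carrier → Carrier
    slice x = ΣP m (λ y → g (x ◂ y))
    slice≈0 : ∀ j → j ≢ i₀ → slice (enum j) ≈ 0#
    slice≈0 j j≢i₀ = ΣP-zero m (λ y → g≈0 _ (λ x≋p → j≢i₀ (enum-injective _ _ (trans (x≋p zero) (sym (enum-index (p zero)))))))

  searchPoint : ∀ {p} m (P : Point m → Set p) → (∀ {x y} → x ≋ y → P x → P y) → (∀ x → Dec (P x)) →
    Σ (Point m) P ⊎ (∀ x → ¬ P x)
  searchPoint zero P P-resp P? with P? (λ ())
  ... | yes p = inj₁ (_ , p)
  ... | no ¬p = inj₂ (λ x px → ¬p (P-resp (λ ()) px))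
  searchPoint (suc m) P P-resp P?
    with searchCarrier (λ x₀ → Σ (Point m) λ y → P (x₀ ◂ y))
           (λ x₀≈x₀' (y , p) → y , P-resp (λ { zero → x₀≈x₀' ; (suc i) → refl }) p) extendable?
    where
    extendable? : ∀ x₀ → Dec (Σ (Point m) λ y → P (x₀ ◂ y))
    extendable? x₀ with searchPoint m (λ y → P (x₀ ◂ y)) (λ y≋y' → P-resp (λ { zero → refl ; (suc i) → y≋y' i })) (P? ∘ (x₀ ◂_))
    ... | inj₁ found = yes found
    ... | inj₂ none  = no (λ (y , p) → none y p)
  ... | inj₁ (x₀ , y , p) = inj₁ (x₀ ◂ y , p)
  ... | inj₂ none         = inj₂ (λ x px → none (x zero) (x ∘ suc , P-resp (λ { zero → refl ; (suc i) → refl }) px))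

module PolynomialFunctions {c ℓ} (F : Field c ℓ) (q₀ : ℕ) (card : FieldTheory.HasCardinality F (suc (suc q₀))) where
  open FiniteSpace F q₀ card public

  Σℕ : ∀ m → (Fin m → ℕ) → ℕ
  Σℕ zero    ex = 0
  Σℕ (suc m) ex = ex zero ℕ.+ Σℕ m (ex ∘ suc)

  Σℕ-zero : ∀ m → Σℕ m (λ _ → 0) ≡ 0
  Σℕ-zero zero    = ≡.refl
  Σℕ-zero (suc m) = Σℕ-zero m

  Σℕ-+ : ∀ m (ex ey : Fin m → ℕ) → Σℕ m (λ i → ex i ℕ.+ ey i) ≡ Σℕ m ex ℕ.+ Σℕ m ey
  Σℕ-+ zero    ex ey = ≡.refl
  Σℕ-+ (suc m) ex ey = ≡.trans (≡.cong (ex zero ℕ.+ ey zero ℕ.+_) (Σℕ-+ m (ex ∘ suc) (ey ∘ suc)))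
                           (interchange (ex zero) (ey zero) (Σℕ m (ex ∘ suc)) (Σℕ m (ey ∘ suc)))
    where open Algebra.Properties.CommutativeSemigroup ℕ.+-commutativeSemigroup using (interchange)

  some-exponent<Q : ∀ m (ex : Fin m → ℕ) → Σℕ m ex < m ℕ.* Q → Σ (Fin m) λ i → ex i < Q
  some-exponent<Q m ex Σex<mQ with Fin.any? (λ i → ex i ℕ.<? Q)
  ... | yes found = found
  ... | no  none  = ⊥-elim (ℕ.<⇒≱ Σex<mQ (all-large m ex (λ i → ℕ.≮⇒≥ (λ exᵢ<Q → none (i , exᵢ<Q)))))
    where
    all-large : ∀ m (ex : Fin m → ℕ) → (∀ i → Q ≤ ex i) → m ℕ.* Q ≤ Σℕ m ex
    all-large zero    ex Q≤ex = ℕ.z≤n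
    all-large (suc m) ex Q≤ex = ℕ.+-mono-≤ (Q≤ex zero) (all-large m (ex ∘ suc) (Q≤ex ∘ suc))

  mono : ∀ {m} → (Fin m → ℕ) → Point m → Carrier
  mono {m} ex x = prodF m (λ i → pow (x i) (ex i))

  mono-cong : ∀ {m} (ex : Fin m → ℕ) → PointCongruent (mono ex)
  mono-cong {m} ex x≋y = prodF-cong m (λ i → pow-cong (ex i) (x≋y i))

  mono-+ : ∀ {m} (ex ey : Fin m → ℕ) x → mono (λ i → ex i ℕ.+ ey i) x ≈ mono ex x * mono ey x
  mono-+ {m} ex ey x = trans (prodF-cong m (λ i → pow-+ (x i) (ex i) (ey i)))
                             (prodF-* m (λ i → pow (x i) (ex i)) (λ i → pow (x i) (ey i)))

  ΣP-mono : ∀ m (ex : Fin m → ℕ) i → ex i < Q → ΣP m (mono ex) ≈ 0#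
  ΣP-mono (suc m) ex i exᵢ<Q = begin
    ΣF (λ x → ΣP m (λ y → pow x (ex zero) * mono (ex ∘ suc) y)) ≈⟨ ΣF-cong (λ x → ΣP-*ˡ m (pow x (ex zero)) (mono (ex ∘ suc))) ⟩
    ΣF (λ x → pow x (ex zero) * rest)                           ≈⟨ sumF-*ʳ q rest (λ j → pow (enum j) (ex zero)) ⟩
    ΣF (λ x → pow x (ex zero)) * rest                           ≈⟨ factor≈0 i exᵢ<Q ⟩
    0#                                                          ∎
    where
    rest = ΣP m (mono (ex ∘ suc))
    factor≈0 : ∀ i → ex i < Q → ΣF (λ x → pow x (ex zero)) * rest ≈ 0#
    factor≈0 zero    ex₀<Q = trans (*-congʳ (ΣF-pow (ex zero) ex₀<Q)) (zeroˡ _)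
    factor≈0 (suc i) exᵢ<Q = trans (*-congˡ (ΣP-mono m (ex ∘ suc) i exᵢ<Q)) (zeroʳ _)

  Terms : ℕ → Set c
  Terms m = List (Carrier × (Fin m → ℕ))

  evalPoly : ∀ {m} → Terms m → Point m → Carrier
  evalPoly []              x = 0#
  evalPoly ((a , ex) ∷ ts) x = a * mono ex x + evalPoly ts x

  evalPoly-cong : ∀ {m} (ts : Terms m) → PointCongruent (evalPoly ts)
  evalPoly-cong []              x≋y = refl
  evalPoly-cong ((a , ex) ∷ ts) x≋y = +-cong (*-congˡ (mono-cong ex x≋y)) (evalPoly-cong ts x≋y)

  evalPoly-++ : ∀ {m} (ts us : Terms m) x → evalPoly (ts ++ us) x ≈ evalPoly ts x + evalPoly us x
  evalPoly-++ []              us x = sym (+-identityˡ _)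
  evalPoly-++ ((a , ex) ∷ ts) us x = trans (+-congˡ (evalPoly-++ ts us x)) (sym (+-assoc _ _ _))

  Deg≤ : ∀ {m} → ℕ → (Point m → Carrier) → Set (c ⊔ ℓ)
  Deg≤ {m} D g = Σ (Terms m) λ ts → All (λ t → Σℕ m (proj₂ t) ≤ D) ts × (∀ x → g x ≈ evalPoly ts x)

  Deg≤⇒cong : ∀ {m D} {g : Point m → Carrier} → Deg≤ D g → PointCongruent g
  Deg≤⇒cong (ts , _ , g≈) {x} {y} x≋y = trans (g≈ x) (trans (evalPoly-cong ts x≋y) (sym (g≈ y)))

  ΣP-Deg≤ : ∀ m {D} {g : Point m → Carrier} → Deg≤ D g → D < m ℕ.* Q → ΣP m g ≈ 0#
  ΣP-Deg≤ m (ts , degs , g≈) D<mQ = trans (ΣP-cong m g≈) (ΣP-evalPoly ts degs)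
    where
    ΣP-evalPoly : ∀ ts → All (λ t → Σℕ m (proj₂ t) ≤ _) ts → ΣP m (evalPoly ts) ≈ 0#
    ΣP-evalPoly []              []             = ΣP-zero m (λ x → refl)
    ΣP-evalPoly ((a , ex) ∷ ts) (deg≤ ∷ degs) = begin
      ΣP m (λ x → a * mono ex x + evalPoly ts x)          ≈⟨ ΣP-+ m _ _ ⟩
      ΣP m (λ x → a * mono ex x) + ΣP m (evalPoly ts)     ≈⟨ +-cong (ΣP-*ˡ m a (mono ex)) (ΣP-evalPoly ts degs) ⟩
      a * ΣP m (mono ex) + 0#                             ≈⟨ +-congʳ (*-congˡ (ΣP-mono m ex i exᵢ<Q)) ⟩
      a * 0# + 0#                                         ≈⟨ trans (+-identityʳ _) (zeroʳ a) ⟩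
      0#                                                  ∎
      where
      i,exᵢ<Q = some-exponent<Q m ex (ℕ.≤-<-trans deg≤ D<mQ)
      i = proj₁ i,exᵢ<Q
      exᵢ<Q = proj₂ i,exᵢ<Q

  no-low-degree-point-indicator : ∀ m {D} {g : Point m → Carrier} → Deg≤ D g → D < m ℕ.* Q →
    (p : Point m) → g p ≈ 1# → ¬ (∀ x → ¬ x ≋ p → g x ≈ 0#)
  no-low-degree-point-indicator m deg-g D<mQ p gp≈1 g≈0 = 0≉1 (begin
    0#      ≈⟨ ΣP-Deg≤ m deg-g D<mQ ⟨
    ΣP m _  ≈⟨ ΣP-single m _ (Deg≤⇒cong deg-g) p g≈0 ⟩
    _       ≈⟨ gp≈1 ⟩
    1#      ∎)

  Deg≤-weaken : ∀ {m D E} {g : Point m → Carrier} → D ≤ E → Deg≤ D g → Deg≤ E g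
  Deg≤-weaken D≤E (ts , degs , g≈) = ts , All.map (λ deg≤D → ℕ.≤-trans deg≤D D≤E) degs , g≈

  Deg≤-cong : ∀ {m D} {g h : Point m → Carrier} → (∀ x → g x ≈ h x) → Deg≤ D g → Deg≤ D h
  Deg≤-cong g≈h (ts , degs , g≈) = ts , degs , (λ x → trans (sym (g≈h x)) (g≈ x))

  Deg≤-const : ∀ {m D} a → Deg≤ {m} D (λ _ → a)
  Deg≤-const {m} a = ((a , λ _ → 0) ∷ []) , (ℕ.≤-trans (ℕ.≤-reflexive (Σℕ-zero m)) ℕ.z≤n ∷ []) ,
    (λ x → sym (trans (+-identityʳ _) (trans (*-congˡ (prodF-one m (λ _ → refl))) (*-identityʳ a))))

  Deg≤-var : ∀ {m} (i : Fin m) → Deg≤ 1 (λ x → x i)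
  Deg≤-var {m} i = ((1# , unit i) ∷ []) , (ℕ.≤-reflexive (Σℕ-unit i) ∷ []) ,
    (λ x → sym (trans (+-identityʳ _) (trans (*-identityˡ _) (mono-unit x))))
    where
    unit : ∀ {m} → Fin m → Fin m → ℕ
    unit zero    zero    = 1
    unit zero    (suc _) = 0
    unit (suc _) zero    = 0
    unit (suc i) (suc j) = unit i j
    Σℕ-unit : ∀ {m} (i : Fin m) → Σℕ m (unit i) ≡ 1
    Σℕ-unit {suc m} zero    = ≡.cong suc (Σℕ-zero m)
    Σℕ-unit         (suc i) = Σℕ-unit i
    unit-≢ : ∀ {m} (i j : Fin m) → j ≢ i → unit i j ≡ 0
    unit-≢ zero    zero    j≢i = ⊥-elim (j≢i ≡.refl)
    unit-≢ zero    (suc j) j≢i = ≡.refl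
    unit-≢ (suc i) zero    j≢i = ≡.refl
    unit-≢ (suc i) (suc j) j≢i = unit-≢ i j (j≢i ∘ ≡.cong suc)
    unit-refl : ∀ {m} (i : Fin m) → unit i i ≡ 1
    unit-refl zero    = ≡.refl
    unit-refl (suc i) = unit-refl i
    mono-unit : ∀ x → mono (unit i) x ≈ x i
    mono-unit x = begin
      mono (unit i) x       ≈⟨ prodF-single m _ i (λ j j≢i → reflexive (≡.cong (pow (x j)) (unit-≢ i j j≢i))) ⟩
      pow (x i) (unit i i)  ≡⟨ ≡.cong (pow (x i)) (unit-refl i) ⟩
      x i * 1#              ≈⟨ *-identityʳ _ ⟩
      x i                   ∎

  Deg≤-+ : ∀ {m D} {g h : Point m → Carrier} → Deg≤ D g → Deg≤ D h → Deg≤ D (λ x → g x + h x)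
  Deg≤-+ (ts , degs , g≈) (us , degs′ , h≈) =
    (ts ++ us) , All.++⁺ degs degs′ , (λ x → trans (+-cong (g≈ x) (h≈ x)) (sym (evalPoly-++ ts us x)))

  private
    scaleTerms : ∀ {m} → Carrier × (Fin m → ℕ) → Terms m → Terms m
    scaleTerms t              []              = []
    scaleTerms (a , ex) ((b , ey) ∷ us) = (a * b , λ i → ex i ℕ.+ ey i) ∷ scaleTerms (a , ex) us

    _*ᵀ_ : ∀ {m} → Terms m → Terms m → Terms m
    []       *ᵀ us = []
    (t ∷ ts) *ᵀ us = scaleTerms t us ++ (ts *ᵀ us)

    evalPoly-scale : ∀ {m} a ex (us : Terms m) x →
      evalPoly (scaleTerms (a , ex) us) x ≈ (a * mono ex x) * evalPoly us x
    evalPoly-scale a ex []              x = sym (zeroʳ _)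
    evalPoly-scale a ex ((b , ey) ∷ us) x = begin
      a * b * mono (λ i → ex i ℕ.+ ey i) x + evalPoly (scaleTerms (a , ex) us) x
        ≈⟨ +-cong (*-congˡ (mono-+ ex ey x)) (evalPoly-scale a ex us x) ⟩
      a * b * (mono ex x * mono ey x) + (a * mono ex x) * evalPoly us x
        ≈⟨ solve 5 (λ a b u v w → a :* b :* (u :* v) :+ (a :* u) :* w := (a :* u) :* (b :* v :+ w))
             refl a b (mono ex x) (mono ey x) (evalPoly us x) ⟩
      (a * mono ex x) * (b * mono ey x + evalPoly us x) ∎

    evalPoly-* : ∀ {m} (ts us : Terms m) x → evalPoly (ts *ᵀ us) x ≈ evalPoly ts x * evalPoly us x
    evalPoly-* []              us x = sym (zeroˡ _)
    evalPoly-* ((a , ex) ∷ ts) us x = begin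
      evalPoly (scaleTerms (a , ex) us ++ (ts *ᵀ us)) x
        ≈⟨ evalPoly-++ (scaleTerms (a , ex) us) (ts *ᵀ us) x ⟩
      evalPoly (scaleTerms (a , ex) us) x + evalPoly (ts *ᵀ us) x
        ≈⟨ +-cong (evalPoly-scale a ex us x) (evalPoly-* ts us x) ⟩
      (a * mono ex x) * evalPoly us x + evalPoly ts x * evalPoly us x
        ≈⟨ distribʳ _ _ _ ⟨
      (a * mono ex x + evalPoly ts x) * evalPoly us x ∎

    degree-* : ∀ {m D E} (ts us : Terms m) → All (λ t → Σℕ m (proj₂ t) ≤ D) ts →
      All (λ t → Σℕ m (proj₂ t) ≤ E) us → All (λ t → Σℕ m (proj₂ t) ≤ D ℕ.+ E) (ts *ᵀ us)
    degree-* []              us []             degs′ = []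
    degree-* {m} {D} {E} ((a , ex) ∷ ts) us (deg≤ ∷ degs) degs′ =
      All.++⁺ (degree-scale us degs′) (degree-* ts us degs degs′)
      where
      degree-scale : ∀ us → All (λ t → Σℕ m (proj₂ t) ≤ E) us →
        All (λ t → Σℕ m (proj₂ t) ≤ D ℕ.+ E) (scaleTerms (a , ex) us)
      degree-scale []              []              = []
      degree-scale ((b , ey) ∷ us) (deg≤′ ∷ degs′) =
        ℕ.≤-trans (ℕ.≤-reflexive (Σℕ-+ m ex ey)) (ℕ.+-mono-≤ deg≤ deg≤′) ∷ degree-scale us degs′

  Deg≤-* : ∀ {m D E} {g h : Point m → Carrier} → Deg≤ D g → Deg≤ E h → Deg≤ (D ℕ.+ E) (λ x → g x * h x)
  Deg≤-* (ts , degs , g≈) (us , degs′ , h≈) =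
    (ts *ᵀ us) , degree-* ts us degs degs′ , (λ x → trans (*-cong (g≈ x) (h≈ x)) (sym (evalPoly-* ts us x)))

  Deg≤-neg : ∀ {m D} {g : Point m → Carrier} → Deg≤ D g → Deg≤ D (λ x → - g x)
  Deg≤-neg deg-g = Deg≤-cong (λ x → solve 1 (λ u → :- con (+ 1) :* u := :- u) refl _) (Deg≤-* (Deg≤-const {D = 0} (- 1#)) deg-g)

  Deg≤-- : ∀ {m D} {g h : Point m → Carrier} → Deg≤ D g → Deg≤ D h → Deg≤ D (λ x → g x - h x)
  Deg≤-- deg-g deg-h = Deg≤-+ deg-g (Deg≤-neg deg-h)

  Deg≤-pow : ∀ {m D} {g : Point m → Carrier} → Deg≤ D g → ∀ k → Deg≤ (k ℕ.* D) (λ x → pow (g x) k)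
  Deg≤-pow deg-g zero    = Deg≤-const 1#
  Deg≤-pow deg-g (suc k) = Deg≤-* deg-g (Deg≤-pow deg-g k)

  Deg≤-χ₀ : ∀ {m D} {g : Point m → Carrier} → Deg≤ D g → Deg≤ (Q ℕ.* D) (λ x → χ₀ (g x))
  Deg≤-χ₀ deg-g = Deg≤-- (Deg≤-const 1#) (Deg≤-pow deg-g Q)

  Deg≤-sumF : ∀ {m D} k (g : Fin k → Point m → Carrier) → (∀ j → Deg≤ D (g j)) →
    Deg≤ D (λ x → sumF k (λ j → g j x))
  Deg≤-sumF zero    g deg-g = Deg≤-const 0#
  Deg≤-sumF (suc k) g deg-g = Deg≤-+ (deg-g zero) (Deg≤-sumF k (g ∘ suc) (deg-g ∘ suc))

  Deg≤-prodF : ∀ {m D} k (g : Fin k → Point m → Carrier) → (∀ j → Deg≤ D (g j)) →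
    Deg≤ (k ℕ.* D) (λ x → prodF k (λ j → g j x))
  Deg≤-prodF zero    g deg-g = Deg≤-const 1#
  Deg≤-prodF (suc k) g deg-g = Deg≤-* (deg-g zero) (Deg≤-prodF k (g ∘ suc) (deg-g ∘ suc))

  Deg≤-eval : ∀ {m} (f : Poly m) → Deg≤ (deg f) (eval f)
  Deg≤-eval f = Deg≤-evalTerms (Poly.terms f)
    where
    monomial≈mono : ∀ {m} (es : Vec ℕ m) x → monomial es x ≈ mono (Vec.lookup es) x
    monomial≈mono []       x = refl
    monomial≈mono (e ∷ es) x = *-congˡ (monomial≈mono es (x ∘ suc))
    totalDegree≡Σℕ : ∀ {m} (es : Vec ℕ m) → totalDegree es ≡ Σℕ m (Vec.lookup es)
    totalDegree≡Σℕ []       = ≡.refl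
    totalDegree≡Σℕ (e ∷ es) = ≡.cong (e ℕ.+_) (totalDegree≡Σℕ es)
    Deg≤-term : ∀ {m} a (es : Vec ℕ m) → Deg≤ (totalDegree es) (λ x → a * monomial es x)
    Deg≤-term a es = ((a , Vec.lookup es) ∷ []) , (ℕ.≤-reflexive (≡.sym (totalDegree≡Σℕ es)) ∷ []) ,
      (λ x → trans (*-congˡ (monomial≈mono es x)) (sym (+-identityʳ _)))
    Deg≤-evalTerms : ∀ {m} (ts : List (Carrier × Vec ℕ m)) → Deg≤ (degTerms ts) (evalTerms ts)
    Deg≤-evalTerms []               = Deg≤-const 0#
    Deg≤-evalTerms ((a , es) ∷ ts) =
      Deg≤-+ (Deg≤-weaken (ℕ.m≤m⊔n (totalDegree es) (degTerms ts)) (Deg≤-term a es))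
             (Deg≤-weaken (ℕ.m≤n⊔m (totalDegree es) (degTerms ts)) (Deg≤-evalTerms ts))

  Deg≤-χ₀-difference : ∀ {m} {h : Point m → Carrier} → Deg≤ 1 h → ∀ a b →
    Deg≤ q₀ (λ x → χ₀ (h x - a) - χ₀ (h x - b))
  Deg≤-χ₀-difference {h = h} deg-h a b =
    Deg≤-cong χ₀-difference (Deg≤-* (Deg≤-const {D = 0} (a - b)) (Deg≤-geometricSum q₀))
    where
    X Y : _ → Carrier
    X x = h x - a
    Y x = h x - b
    Deg≤-geometricSum : ∀ k → Deg≤ k (λ x → geometricSum k (X x) (Y x))
    Deg≤-geometricSum zero    = Deg≤-const 1#
    Deg≤-geometricSum (suc k) =
      Deg≤-+ (Deg≤-* (Deg≤-- deg-h (Deg≤-const b)) (Deg≤-geometricSum k))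
             (Deg≤-weaken (ℕ.≤-reflexive (ℕ.*-identityʳ (suc k))) (Deg≤-pow (Deg≤-- deg-h (Deg≤-const a)) (suc k)))
    χ₀-difference : ∀ x → (a - b) * geometricSum q₀ (X x) (Y x) ≈ χ₀ (X x) - χ₀ (Y x)
    χ₀-difference x = sym (begin
      χ₀ (X x) - χ₀ (Y x)               ≈⟨ solve 3 (λ o u v → (o :- u) :- (o :- v) := v :- u) refl 1# (pow (X x) Q) (pow (Y x) Q) ⟩
      pow (Y x) Q - pow (X x) Q         ≈⟨ pow-difference q₀ (X x) (Y x) ⟩
      (Y x - X x) * geometricSum q₀ (X x) (Y x)
        ≈⟨ *-congʳ (solve 3 (λ z u v → (z :- v) :- (z :- u) := u :- v) refl (h x) a b) ⟩
      (a - b) * geometricSum q₀ (X x) (Y x) ∎)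

  Deg≤-prodF-difference : ∀ {m D E} k (f g : Fin (suc k) → Point m → Carrier) →
    (∀ j → Deg≤ D (f j)) → (∀ j → Deg≤ D (g j)) → (∀ j → Deg≤ E (λ x → f j x - g j x)) →
    Deg≤ (k ℕ.* D ℕ.+ E) (λ x → prodF (suc k) (λ j → f j x) - prodF (suc k) (λ j → g j x))
  Deg≤-prodF-difference zero f g deg-f deg-g deg-f-g =
    Deg≤-cong (λ x → solve 2 (λ u v → u :- v := u :* con (+ 1) :- v :* con (+ 1)) refl (f zero x) (g zero x)) (deg-f-g zero)
  Deg≤-prodF-difference {D = D} {E} (suc k) f g deg-f deg-g deg-f-g =
    Deg≤-cong telescope
      (Deg≤-+ (Deg≤-weaken (ℕ.≤-reflexive (≡.sym (ℕ.+-assoc D (k ℕ.* D) E)))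
                           (Deg≤-* (deg-f zero) (Deg≤-prodF-difference k (f ∘ suc) (g ∘ suc) (deg-f ∘ suc) (deg-g ∘ suc) (deg-f-g ∘ suc))))
              (Deg≤-weaken (ℕ.≤-reflexive (ℕ.+-comm E (suc k ℕ.* D)))
                           (Deg≤-* (deg-f-g zero) (Deg≤-prodF (suc k) (g ∘ suc) (deg-g ∘ suc)))))
    where
    telescope : ∀ x → f zero x * (prodF (suc k) (λ j → f (suc j) x) - prodF (suc k) (λ j → g (suc j) x))
                        + (f zero x - g zero x) * prodF (suc k) (λ j → g (suc j) x)
                      ≈ f zero x * prodF (suc k) (λ j → f (suc j) x) - g zero x * prodF (suc k) (λ j → g (suc j) x)
    telescope x = solve 4 (λ a b A B → a :* (A :- B) :+ (a :- b) :* B := a :* A :- b :* B) refl (f zero x) (g zero x) _ _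

  linear-system-nontrivial : ∀ e u (A : Fin e → Fin u → Carrier) → e < u →
    ¬ (∀ y → (∀ i → sumF u (λ j → A i j * y j) ≈ 0#) → y ≋ (λ _ → 0#))
  linear-system-nontrivial e u A e<u only-trivial =
    no-low-degree-point-indicator u (Deg≤-prodF e (λ i y → χ₀ (L i y)) Deg≤-χ₀∘L) (ℕ.*-monoˡ-< Q e<u)
      (λ _ → 0#) (prodF-one e (λ i → χ₀-zero (sumF-zero u (λ j → zeroʳ _)))) g≈0
    where
    L : Fin e → Point u → Carrier
    L i y = sumF u (λ j → A i j * y j)
    Deg≤-χ₀∘L : ∀ i → Deg≤ Q (λ y → χ₀ (L i y))
    Deg≤-χ₀∘L i = Deg≤-weaken (ℕ.≤-reflexive (ℕ.*-identityʳ Q))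
      (Deg≤-χ₀ (Deg≤-sumF u (λ j y → A i j * y j) (λ j → Deg≤-* (Deg≤-const {D = 0} (A i j)) (Deg≤-var j))))
    g≈0 : ∀ y → ¬ y ≋ (λ _ → 0#) → prodF e (λ i → χ₀ (L i y)) ≈ 0#
    g≈0 y y≉0 with Fin.all? (λ i → L i y ≈? 0#)
    ... | yes solution = ⊥-elim (y≉0 (only-trivial y solution))
    ... | no  ¬solution with Fin.¬∀⟶∃¬ e _ (λ i → L i y ≈? 0#) ¬solution
    ...   | i , Lᵢ≉0 = prodF-zero e _ i (χ₀-nonzero Lᵢ≉0)

module AffineFrames {c ℓ} (F : Field c ℓ) (q₀ : ℕ) (card : FieldTheory.HasCardinality F (suc (suc q₀))) where
  open PolynomialFunctions F q₀ card public

  -- The affine space P₀ + span(u) in echelon form: coordinate σ i of u j is δ j i, so its points are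
  -- parametrised by their coordinates at the pivots σ.
  module AffineFrame {n s : ℕ} (P₀ : Point n) (σ : Fin s → Fin n) (u : Fin s → Point n)
                     (pivots : ∀ j i → u j (σ i) ≈ δ j i) where
    φ : Point s → Point n
    φ y i = P₀ i + lin y u i

    coord : Point n → Point s
    coord x j = x (σ j) - P₀ (σ j)

    InSpan : Point n → Set ℓ
    InSpan x = x ≋ φ (coord x)

    lin-σ : ∀ (y : Point s) j → lin y u (σ j) ≈ y j
    lin-σ y j = begin
      sumF s (λ k → y k * u k (σ j))  ≈⟨ sumF-cong s (λ k → trans (*-congˡ (pivots k j)) (*-comm _ _)) ⟩
      sumF s (λ k → δ k j * y k)      ≈⟨ sumF-single s _ j (λ k k≢j → trans (*-congʳ (δ-≢ k j k≢j)) (zeroˡ _)) ⟩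
      δ j j * y j                     ≈⟨ trans (*-congʳ (δ-refl j)) (*-identityˡ _) ⟩
      y j                             ∎

    φ-σ : ∀ y j → φ y (σ j) ≈ P₀ (σ j) + y j
    φ-σ y j = +-congˡ (lin-σ y j)

    coord-φ : ∀ y → coord (φ y) ≋ y
    coord-φ y j = trans (+-congʳ (φ-σ y j)) (solve 2 (λ a b → a :+ b :- a := b) refl _ _)

    φ-cong : ∀ {y y'} → y ≋ y' → φ y ≋ φ y'
    φ-cong y≋y' i = +-congˡ (lin-cong u y≋y' i)

    coord-cong : ∀ {x x'} → x ≋ x' → coord x ≋ coord x'
    coord-cong x≋x' j = +-congʳ (x≋x' (σ j))

    φ-InSpan : ∀ y → InSpan (φ y)
    φ-InSpan y = φ-cong (λ j → sym (coord-φ y j))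

    InSpan-resp : ∀ {x x'} → x ≋ x' → InSpan x → InSpan x'
    InSpan-resp x≋x' x∈ i = trans (sym (x≋x' i)) (trans (x∈ i) (φ-cong (coord-cong x≋x') i))

    InSpan? : ∀ x → Dec (InSpan x)
    InSpan? x = Fin.all? (λ i → x i ≈? φ (coord x) i)

    u-independent : LinearlyIndependent u
    u-independent cs lin≈0 j = trans (sym (lin-σ cs j)) (lin≈0 (σ j))

    InSpan-≋-at-pivots : ∀ {z z'} → InSpan z → InSpan z' → (∀ j → z (σ j) ≈ z' (σ j)) → z ≋ z'
    InSpan-≋-at-pivots z∈ z'∈ z≈z' i = trans (z∈ i) (trans (φ-cong (λ j → +-congʳ (z≈z' j)) i) (sym (z'∈ i)))

    pivotFactor : Point n → Fin s → Point n → Carrier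
    pivotFactor z j x = χ₀ (x (σ j) - z (σ j))

    Deg≤-pivotFactor : ∀ z j → Deg≤ Q (pivotFactor z j)
    Deg≤-pivotFactor z j =
      Deg≤-weaken (ℕ.≤-reflexive (ℕ.*-identityʳ Q)) (Deg≤-χ₀ (Deg≤-- (Deg≤-var (σ j)) (Deg≤-const _)))

    pivotIndicator : Point n → Point n → Carrier
    pivotIndicator z x = prodF s (λ j → pivotFactor z j x)

    pivotIndicator-self : ∀ z → pivotIndicator z z ≈ 1#
    pivotIndicator-self z = prodF-one s (λ j → χ₀-zero (-‿inverseʳ (z (σ j))))

    pivotIndicator-other : ∀ z x → ¬ (∀ j → x (σ j) ≈ z (σ j)) → pivotIndicator z x ≈ 0#
    pivotIndicator-other z x differ with Fin.¬∀⟶∃¬ s _ (λ j → x (σ j) ≈? z (σ j)) differ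
    ... | j , xⱼ≉zⱼ = prodF-zero s (λ j → pivotFactor z j x) j (χ₀-nonzero (xⱼ≉zⱼ ∘ x-y≈0⇒x≈y))

    offset-at : ∀ t z → z t - P₀ t ≈ (z t - φ (coord z) t) + lin (coord z) u t
    offset-at t z = solve 3 (λ z p l → z :- p := (z :- (p :+ l)) :+ l) refl (z t) (P₀ t) (lin (coord z) u t)

  affine-combination≈0 : ∀ {n K k} (a : Point n) (vs : Fin k → Point n) (cs : Fin K → Fin k → Carrier)
    (xs : Fin K → Point n) → (∀ j i → xs j i ≈ a i + lin (cs j) vs i) →
    (λs : Fin K → Carrier) → sumF K λs ≈ 0# → (∀ m → sumF K (λ j → λs j * cs j m) ≈ 0#) →
    ∀ b i → sumF K (λ j → λs j * (xs j i - b)) ≈ 0#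
  affine-combination≈0 {K = K} {k} a vs cs xs xs≈ λs Σλ≈0 Σλc≈0 b i = begin
    sumF K (λ j → λs j * (xs j i - b))
      ≈⟨ sumF-cong K (λ j → trans (*-congˡ (+-congʳ (xs≈ j i)))
           (solve 4 (λ l a m b → l :* ((a :+ m) :- b) := (l :* a :+ l :* m) :- l :* b) refl (λs j) (a i) (lin (cs j) vs i) b)) ⟩
    sumF K (λ j → (λs j * a i + λs j * lin (cs j) vs i) - λs j * b)
      ≈⟨ trans (sumF-- K _ _) (+-congʳ (sumF-+ K _ _)) ⟩
    (sumF K (λ j → λs j * a i) + sumF K (λ j → λs j * lin (cs j) vs i)) - sumF K (λ j → λs j * b)
      ≈⟨ +-cong (+-cong (trans (sumF-*ʳ K (a i) λs) (Σλ*≈0 (a i))) (trans (lin-assoc λs cs vs i) (lin-zero vs Σλc≈0 i)))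
                (-‿cong (trans (sumF-*ʳ K b λs) (Σλ*≈0 b))) ⟩
    (0# + 0#) - 0#
      ≈⟨ solve 0 ((con (+ 0) :+ con (+ 0)) :- con (+ 0) := con (+ 0)) refl ⟩
    0# ∎
    where
    Σλ*≈0 : ∀ y → sumF K λs * y ≈ 0#
    Σλ*≈0 y = trans (*-congʳ Σλ≈0) (zeroˡ y)

separator-degree<nQ : ∀ q₀ d s n → suc s ℕ.+ d ≤ n →
  suc q₀ ℕ.* d ℕ.+ (s ℕ.* suc q₀ ℕ.+ q₀) < n ℕ.* suc q₀
separator-degree<nQ q₀ d s n s+d≤n = begin-strict
  Q ℕ.* d ℕ.+ (s ℕ.* Q ℕ.+ q₀)  <⟨ ℕ.+-monoʳ-< (Q ℕ.* d) (ℕ.+-monoʳ-< (s ℕ.* Q) (ℕ.n<1+n q₀)) ⟩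
  Q ℕ.* d ℕ.+ (s ℕ.* Q ℕ.+ Q)   ≡⟨ solve 3 (λ Q d s → Q :* d :+ (s :* Q :+ Q) := (con 1 :+ s :+ d) :* Q) ≡.refl Q d s ⟩
  (suc s ℕ.+ d) ℕ.* Q            ≤⟨ ℕ.*-monoˡ-≤ Q s+d≤n ⟩
  n ℕ.* Q                        ∎
  where
  open ℕ.≤-Reasoning
  open Data.Nat.Solver.+-*-Solver using (solve; _:*_; _:+_; _:=_; con)
  Q = suc q₀

module ZeroSetConstruction {c ℓ} (F : Field c ℓ) (q₀ : ℕ) (card : FieldTheory.HasCardinality F (suc (suc q₀)))
                           (n : ℕ) (fs : List (FieldTheory.Poly F n)) where
  open AffineFrames F q₀ card public

  Z? : ∀ x → Dec (Z fs x)
  Z? x = All.all? (λ f → eval f x ≈? 0#) fs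

  Z-resp : ∀ {x y} → x ≋ y → Z fs x → Z fs y
  Z-resp x≋y = All.map (λ {f} fx≈0 → trans (Deg≤⇒cong (Deg≤-eval f) (λ i → sym (x≋y i))) fx≈0)

  d : ℕ
  d = sum (map deg fs)

  χZ : List (Poly n) → Point n → Carrier
  χZ []       x = 1#
  χZ (f ∷ gs) x = χ₀ (eval f x) * χZ gs x

  Deg≤-χZ : ∀ gs → Deg≤ (Q ℕ.* sum (map deg gs)) (χZ gs)
  Deg≤-χZ []       = Deg≤-const 1#
  Deg≤-χZ (f ∷ gs) = Deg≤-weaken (ℕ.≤-reflexive (≡.sym (ℕ.*-distribˡ-+ Q (deg f) (sum (map deg gs)))))
                                 (Deg≤-* (Deg≤-χ₀ (Deg≤-eval f)) (Deg≤-χZ gs))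

  χZ-∈ : ∀ gs {x} → Z gs x → χZ gs x ≈ 1#
  χZ-∈ []       _              = refl
  χZ-∈ (f ∷ gs) (fx≈0 ∷ x∈Z) = trans (*-cong (χ₀-zero fx≈0) (χZ-∈ gs x∈Z)) (*-identityˡ 1#)

  χZ-∉ : ∀ gs {x} → ¬ Z gs x → χZ gs x ≈ 0#
  χZ-∉ []       x∉Z = ⊥-elim (x∉Z [])
  χZ-∉ (f ∷ gs) {x} x∉Z with eval f x ≈? 0#
  ... | no  fx≉0 = trans (*-congʳ (χ₀-nonzero fx≉0)) (zeroˡ _)
  ... | yes fx≈0 = trans (*-congˡ (χZ-∉ gs (λ x∈Z → x∉Z (fx≈0 ∷ x∈Z)))) (zeroʳ _)

  record IndependentZeros (s : ℕ) : Set (c ⊔ ℓ) where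
    field
      P      : Fin (suc s) → Point n
      σ      : Fin s → Fin n
      u      : Fin s → Point n
      pivots : ∀ j i → u j (σ i) ≈ δ j i
      P∈Z    : ∀ l → Z fs (P l)
    open AffineFrame (P zero) σ u pivots public
    field
      independent : LinearlyIndependent (coord ∘ P ∘ suc)
      P∈span      : ∀ l → InSpan (P l)

  singleton : ∀ {x} → Z fs x → IndependentZeros 0
  singleton {x} x∈Z = record
    { P = λ _ → x ; σ = λ () ; u = λ () ; pivots = λ () ; P∈Z = λ _ → x∈Z
    ; independent = λ _ _ () ; P∈span = λ _ i → sym (+-identityʳ _) }

  -- Adjoin a zero x outside the span: the new pivot t is a coordinate where x differs from its projection
  -- φ (coord x) onto the span, and the old basis vectors are cleared at t.
  module Extension {s} (S : IndependentZeros s) {x} (x∈Z : Z fs x) (x∉span : ¬ IndependentZeros.InSpan S x) where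
    open IndependentZeros S

    r : Point n
    r i = x i - φ (coord x) i

    pivot : Σ (Fin n) λ t → r t ≉ 0#
    pivot with Fin.¬∀⟶∃¬ n _ (λ i → x i ≈? φ (coord x) i) x∉span
    ... | t , xₜ≉ = t , (xₜ≉ ∘ x-y≈0⇒x≈y)

    t = proj₁ pivot
    rₜ≉0 = proj₂ pivot
    rₜ⁻¹ = proj₁ (inverse (r t) rₜ≉0)

    û : Point n
    û i = r i * rₜ⁻¹

    ûₜ≈1 : û t ≈ 1#
    ûₜ≈1 = proj₂ (inverse (r t) rₜ≉0)

    û-σ : ∀ j → û (σ j) ≈ 0#
    û-σ j = trans (*-congʳ r-σ) (zeroˡ _)
      where
      r-σ : r (σ j) ≈ 0#
      r-σ = trans (+-congˡ (-‿cong (φ-σ (coord x) j)))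
                  (solve 2 (λ a b → a :- (b :+ (a :- b)) := con (+ 0)) refl (x (σ j)) (P zero (σ j)))

    σ′ : Fin (suc s) → Fin n
    σ′ zero    = t
    σ′ (suc j) = σ j

    u′ : Fin (suc s) → Point n
    u′ zero      = û
    u′ (suc j) i = u j i - u j t * û i

    pivots′ : ∀ j i → u′ j (σ′ i) ≈ δ j i
    pivots′ zero    zero    = ûₜ≈1
    pivots′ zero    (suc i) = û-σ i
    pivots′ (suc j) zero    = x≈y⇒x-y≈0 (sym (trans (*-congˡ ûₜ≈1) (*-identityʳ _)))
    pivots′ (suc j) (suc i) = trans (+-cong (pivots j i) (-‿cong (trans (*-congˡ (û-σ i)) (zeroʳ _))))
                                    (solve 1 (λ a → a :- con (+ 0) := a) refl (δ j i))

    module New = AffineFrame (P zero) σ′ u′ pivots′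

    New-φ-coord : ∀ z i → New.φ (New.coord z) i ≈ φ (coord z) i + (z t - φ (coord z) t) * û i
    New-φ-coord z i = begin
      P zero i + ((z t - P zero t) * û i + sumF s (λ j → coord z j * (u j i - u j t * û i)))
        ≈⟨ +-congˡ (+-congˡ (trans (sumF-cong s (λ j → solve 4 (λ c a b k → c :* (a :- b :* k) := c :* a :- (c :* b) :* k)
                                                               refl (coord z j) (u j i) (u j t) (û i)))
                             (trans (sumF-- s _ _) (+-congˡ (-‿cong (sumF-*ʳ s (û i) (λ j → coord z j * u j t))))))) ⟩
      P zero i + ((z t - P zero t) * û i + (lin (coord z) u i - lin (coord z) u t * û i))
        ≈⟨ solve 6 (λ p zₜ pₜ ûᵢ lᵢ lₜ → p :+ ((zₜ :- pₜ) :* ûᵢ :+ (lᵢ :- lₜ :* ûᵢ)) := (p :+ lᵢ) :+ (zₜ :- (pₜ :+ lₜ)) :* ûᵢ)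
             refl (P zero i) (z t) (P zero t) (û i) (lin (coord z) u i) (lin (coord z) u t) ⟩
      φ (coord z) i + (z t - φ (coord z) t) * û i ∎

    span⊆New : ∀ {z} → InSpan z → New.InSpan z
    span⊆New {z} z∈ i = sym (begin
      New.φ (New.coord z) i                          ≈⟨ New-φ-coord z i ⟩
      φ (coord z) i + (z t - φ (coord z) t) * û i    ≈⟨ +-cong (sym (z∈ i)) (*-congʳ (x≈y⇒x-y≈0 (z∈ t))) ⟩
      z i + 0# * û i                                 ≈⟨ trans (+-congˡ (zeroˡ _)) (+-identityʳ _) ⟩
      z i                                            ∎)

    x∈New : New.InSpan x
    x∈New i = sym (begin
      New.φ (New.coord x) i                ≈⟨ New-φ-coord x i ⟩
      φ (coord x) i + r t * (r i * rₜ⁻¹)   ≈⟨ +-congˡ (solve 3 (λ a b c → a :* (b :* c) := (a :* c) :* b) refl (r t) (r i) rₜ⁻¹) ⟩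
      φ (coord x) i + (r t * rₜ⁻¹) * r i   ≈⟨ +-congˡ (trans (*-congʳ ûₜ≈1) (*-identityˡ _)) ⟩
      φ (coord x) i + r i                  ≈⟨ solve 2 (λ a b → a :+ (b :- a) := b) refl (φ (coord x) i) (x i) ⟩
      x i                                  ∎)

    P′ : Fin (suc (suc s)) → Point n
    P′ zero          = P zero
    P′ (suc zero)    = x
    P′ (suc (suc l)) = P (suc l)

    P′∈Z : ∀ l → Z fs (P′ l)
    P′∈Z zero          = P∈Z zero
    P′∈Z (suc zero)    = x∈Z
    P′∈Z (suc (suc l)) = P∈Z (suc l)

    P′∈New : ∀ l → New.InSpan (P′ l)
    P′∈New zero          = span⊆New (P∈span zero)
    P′∈New (suc zero)    = x∈New
    P′∈New (suc (suc l)) = span⊆New (P∈span (suc l))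

    New-independent : LinearlyIndependent (New.coord ∘ P′ ∘ suc)
    New-independent c comb≈0 = c≈0
      where
      w = coord ∘ P ∘ suc
      y : Point s
      y j = c zero * coord x j + lin (c ∘ suc) w j
      c₀rₜ≈0 : c zero * r t ≈ 0#
      c₀rₜ≈0 = begin
        c zero * r t                                              ≈⟨ +-identityʳ _ ⟨
        c zero * r t + 0#                                         ≈⟨ +-congˡ (lin-zero u (comb≈0 ∘ suc) t) ⟨
        c zero * r t + lin y u t                                  ≈⟨ +-congˡ (lin-+ _ _ u t) ⟩
        c zero * r t + (lin (λ j → c zero * coord x j) u t + lin (lin (c ∘ suc) w) u t)
          ≈⟨ +-congˡ (+-cong (lin-*ˡ (c zero) (coord x) u t) (sym (lin-assoc (c ∘ suc) w u t))) ⟩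
        c zero * r t + (c zero * lin (coord x) u t + sumF s (λ l → c (suc l) * lin (w l) u t))
          ≈⟨ solve 4 (λ c r l S → c :* r :+ (c :* l :+ S) := c :* (r :+ l) :+ S) refl (c zero) (r t) _ _ ⟩
        c zero * (r t + lin (coord x) u t) + sumF s (λ l → c (suc l) * lin (w l) u t)
          ≈⟨ +-cong (*-congˡ (sym (offset-at t x)))
                    (sumF-cong s (λ l → *-congˡ (sym (trans (offset-at t (P (suc l)))
                                                      (trans (+-congʳ (x≈y⇒x-y≈0 (P∈span (suc l) t))) (+-identityˡ _)))))) ⟩
        c zero * (x t - P zero t) + sumF s (λ l → c (suc l) * (P (suc l) t - P zero t))
          ≈⟨ comb≈0 zero ⟩
        0# ∎
      c₀≈0 : c zero ≈ 0#
      c₀≈0 = x*y≈0⇒y≈0 rₜ≉0 (trans (*-comm _ _) c₀rₜ≈0)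
      c≈0 : ∀ l → c l ≈ 0#
      c≈0 zero    = c₀≈0
      c≈0 (suc l) = independent (c ∘ suc)
        (λ i → trans (sym (trans (+-congʳ (trans (*-congʳ c₀≈0) (zeroˡ _))) (+-identityˡ _))) (comb≈0 (suc i))) l

    extended : IndependentZeros (suc s)
    extended = record
      { P = P′ ; σ = σ′ ; u = u′ ; pivots = pivots′ ; P∈Z = P′∈Z
      ; independent = New-independent ; P∈span = P′∈New }

  -- If Z ⊆ span but b = φ y ∉ Z, then χZ · (pivotIndicator P₀ − pivotIndicator b) is the indicator of P₀.
  span⊆Z : ∀ {s} (S : IndependentZeros s) → s ℕ.+ d ≤ n →
    (∀ x → Z fs x → IndependentZeros.InSpan S x) → ∀ y → Z fs (IndependentZeros.φ S y)
  span⊆Z {zero}   S _        _       y = Z-resp (λ i → sym (+-identityʳ _)) (IndependentZeros.P∈Z S zero)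
  span⊆Z {suc s′} S s+d≤n Z⊆span y with Z? (IndependentZeros.φ S y)
  ... | yes φy∈Z = φy∈Z
  ... | no  b∉Z  = ⊥-elim (no-low-degree-point-indicator n (Deg≤-* (Deg≤-χZ fs) Deg≤-difference)
                             (separator-degree<nQ q₀ d s′ n s+d≤n) (P zero) g-P₀ g-elsewhere)
    where
    open IndependentZeros S
    b = φ y

    Deg≤-difference : Deg≤ (s′ ℕ.* Q ℕ.+ q₀) (λ x → pivotIndicator (P zero) x - pivotIndicator b x)
    Deg≤-difference = Deg≤-prodF-difference s′ (pivotFactor (P zero)) (pivotFactor b)
      (Deg≤-pivotFactor (P zero)) (Deg≤-pivotFactor b) (λ j → Deg≤-χ₀-difference (Deg≤-var (σ j)) (P zero (σ j)) (b (σ j)))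

    differs-from-b : ∀ {x} → Z fs x → InSpan x → ¬ (∀ j → x (σ j) ≈ b (σ j))
    differs-from-b x∈Z x∈span x≈b = b∉Z (Z-resp (InSpan-≋-at-pivots x∈span (φ-InSpan y) x≈b) x∈Z)

    g-P₀ : χZ fs (P zero) * (pivotIndicator (P zero) (P zero) - pivotIndicator b (P zero)) ≈ 1#
    g-P₀ = begin
      χZ fs (P zero) * (pivotIndicator (P zero) (P zero) - pivotIndicator b (P zero))
        ≈⟨ *-cong (χZ-∈ fs (P∈Z zero)) (+-cong (pivotIndicator-self (P zero))
                  (-‿cong (pivotIndicator-other b (P zero) (differs-from-b (P∈Z zero) (P∈span zero))))) ⟩
      1# * (1# - 0#)
        ≈⟨ solve 0 (con (+ 1) :* (con (+ 1) :- con (+ 0)) := con (+ 1)) refl ⟩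
      1# ∎

    g-elsewhere : ∀ x → ¬ x ≋ P zero → χZ fs x * (pivotIndicator (P zero) x - pivotIndicator b x) ≈ 0#
    g-elsewhere x x≢P₀ with Z? x
    ... | no  x∉Z = trans (*-congʳ (χZ-∉ fs x∉Z)) (zeroˡ _)
    ... | yes x∈Z = trans (*-congˡ (x≈y⇒x-y≈0 (trans
            (pivotIndicator-other (P zero) x (x≢P₀ ∘ InSpan-≋-at-pivots x∈span (P∈span zero)))
            (sym (pivotIndicator-other b x (differs-from-b x∈Z x∈span)))))) (zeroʳ _)
      where x∈span = Z⊆span x x∈Z

  Z⊈span : ∀ {s} (S : IndependentZeros s) → s ℕ.+ d ≤ n → ¬ IsAffineSpace (Z fs) →
    ¬ (∀ x → Z fs x → IndependentZeros.InSpan S x)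
  Z⊈span {s} S s+d≤n not-affine Z⊆span = not-affine (s , P zero , u , u-independent , λ x →
    (λ x∈Z → coord x , Z⊆span x x∈Z) , (λ (cs , x≈φcs) → Z-resp (λ i → sym (x≈φcs i)) (span⊆Z S s+d≤n Z⊆span cs)))
    where open IndependentZeros S

  enlarge : ∀ {s} → s ℕ.+ d ≤ n → ¬ IsAffineSpace (Z fs) → IndependentZeros s → IndependentZeros (suc s)
  enlarge s+d≤n not-affine S
    with searchPoint n (λ x → Z fs x × ¬ InSpan x)
           (λ x≋y (x∈Z , x∉) → Z-resp x≋y x∈Z , (λ y∈ → x∉ (InSpan-resp (λ i → sym (x≋y i)) y∈)))
           (λ x → Z? x ×-dec ¬? (InSpan? x))
    where open IndependentZeros S
  ... | inj₁ (x , x∈Z , x∉span) = Extension.extended S x∈Z x∉span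
  ... | inj₂ none = ⊥-elim (Z⊈span S s+d≤n not-affine
          (λ x x∈Z → decidable-stable (IndependentZeros.InSpan? S x) (λ x∉ → none x (x∈Z , x∉))))

  grow : ∀ s → s ℕ.+ d ≤ suc n → ¬ IsAffineSpace (Z fs) → Σ (Point n) (Z fs) → IndependentZeros s
  grow zero    _           _          (x , x∈Z) = singleton x∈Z
  grow (suc s) s+d<n+1 not-affine z =
    enlarge (ℕ.≤-pred s+d<n+1) not-affine (grow s (ℕ.m≤n⇒m≤1+n (ℕ.≤-pred s+d<n+1)) not-affine z)

  affinely-independent : ∀ {s K} (S : IndependentZeros s) (ι : Fin K → Fin (suc s)) → Injective _≡_ _≡_ ι →
    (λs : Fin K → Carrier) → sumF K λs ≈ 0# →
    (∀ i → sumF K (λ j → λs j * IndependentZeros.coord S (IndependentZeros.P S (ι j)) i) ≈ 0#) →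
    ∀ j → λs j ≈ 0#
  affinely-independent {s} {K} S ι ι-injective λs Σλ≈0 Σλcoord≈0 = λ≈0
    where
    open IndependentZeros S
    w = coord ∘ P ∘ suc

    coord-P : ∀ l′ i → coord (P l′) i ≈ sumF s (λ l → δ l′ (suc l) * w l i)
    coord-P zero     i = trans (-‿inverseʳ _) (sym (sumF-zero s (λ l → zeroˡ (w l i))))
    coord-P (suc l₀) i = sym (sumF-δ s (λ l → w l i) l₀)

    μ : Fin s → Carrier
    μ l = sumF K (λ j → λs j * δ (ι j) (suc l))

    μ≈0 : ∀ l → μ l ≈ 0#
    μ≈0 = independent μ (λ i → begin
      sumF s (λ l → μ l * w l i)                                     ≈⟨ sumF-assoc K s λs (λ j l → δ (ι j) (suc l)) (λ l → w l i) ⟨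
      sumF K (λ j → λs j * sumF s (λ l → δ (ι j) (suc l) * w l i))  ≈⟨ sumF-cong K (λ j → *-congˡ (sym (coord-P (ι j) i))) ⟩
      sumF K (λ j → λs j * coord (P (ι j)) i)                        ≈⟨ Σλcoord≈0 i ⟩
      0#                                                             ∎)

    λ≈0-off-P₀ : ∀ j l → ι j ≡ suc l → λs j ≈ 0#
    λ≈0-off-P₀ j l ιj≡ = begin
      λs j                     ≈⟨ *-identityʳ _ ⟨
      λs j * 1#                ≈⟨ *-congˡ (≡.subst (λ z → δ z (suc l) ≈ 1#) (≡.sym ιj≡) (δ-refl (suc l))) ⟨
      λs j * δ (ι j) (suc l)   ≈⟨ sumF-single K (λ j′ → λs j′ * δ (ι j′) (suc l)) j (λ j′ j′≢j →
                                    trans (*-congˡ (δ-≢ (ι j′) (suc l) (λ ιj′≡ → j′≢j (ι-injective (≡.trans ιj′≡ (≡.sym ιj≡))))))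
                                          (zeroʳ _)) ⟨
      μ l                      ≈⟨ μ≈0 l ⟩
      0#                       ∎

    λ≈0 : ∀ j → λs j ≈ 0#
    λ≈0 j with ι j in ιj≡
    ... | suc l = λ≈0-off-P₀ j l ιj≡
    ... | zero  = trans (sym (sumF-single K λs j others≈0)) Σλ≈0
      where
      others≈0 : ∀ j′ → j′ ≢ j → λs j′ ≈ 0#
      others≈0 j′ j′≢j with ι j′ in ιj′≡
      ... | zero  = ⊥-elim (j′≢j (ι-injective (≡.trans ιj′≡ (≡.sym ιj≡))))
      ... | suc l = λ≈0-off-P₀ j′ l ιj′≡

  -- A encodes the equations Σⱼ λⱼ = 0 and Σⱼ λⱼ cⱼₘ = 0, where cⱼ are the coordinates of the chosen points
  -- in the affine space a + span(vs).
  independent⇒general-position : ∀ {s} (S : IndependentZeros s) → GeneralPosition (IndependentZeros.P S)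
  independent⇒general-position S k _ ι ι-injective (a , vs , _ , on) =
    linear-system-nontrivial (suc k) (suc (suc k)) A (ℕ.n<1+n _) λ λs solves →
      affinely-independent S ι ι-injective λs (Σλ≈0 λs solves)
        (λ i → affine-combination≈0 a vs cs (P ∘ ι) (λ j → proj₂ (on j)) λs (Σλ≈0 λs solves)
                 (λ m → trans (sumF-cong (suc (suc k)) (λ j → *-comm (λs j) (cs j m))) (solves (suc m))) (P zero (σ i)) (σ i))
    where
    open IndependentZeros S
    cs : Fin (suc (suc k)) → Fin k → Carrier
    cs j = proj₁ (on j)
    A : Fin (suc k) → Fin (suc (suc k)) → Carrier
    A zero    j = 1#
    A (suc m) j = cs j m
    Σλ≈0 : ∀ λs → (∀ m → sumF (suc (suc k)) (λ j → A m j * λs j) ≈ 0#) → sumF (suc (suc k)) λs ≈ 0#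
    Σλ≈0 λs solves = trans (sumF-cong (suc (suc k)) (λ j → sym (*-identityˡ (λs j)))) (solves zero)

  general-position-zeros : d < n → Σ (Point n) (Z fs) → ¬ IsAffineSpace (Z fs) →
    Σ (Fin (n ℕ.+ 2 ℕ.∸ d) → Point n) λ pts → (∀ i → Z fs (pts i)) × GeneralPosition pts
  general-position-zeros d<n z not-affine =
    ≡.subst (λ N → Σ (Fin N → Point n) λ pts → (∀ i → Z fs (pts i)) × GeneralPosition pts) (≡.sym N≡)
      (P , P∈Z , independent⇒general-position S)
    where
    d≤n+1 : d ≤ suc n
    d≤n+1 = ℕ.m≤n⇒m≤1+n (ℕ.<⇒≤ d<n)
    S = grow (suc n ℕ.∸ d) (ℕ.≤-reflexive (ℕ.m∸n+n≡m d≤n+1)) not-affine z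
    open IndependentZeros S using (P; P∈Z)
    N≡ : n ℕ.+ 2 ℕ.∸ d ≡ suc (suc n ℕ.∸ d)
    N≡ = ≡.trans (≡.cong (ℕ._∸ d) (ℕ.+-comm n 2)) (ℕ.+-∸-assoc 1 d≤n+1)

open import Data.Nat using (_+_; _∸_)

-- A field has 0 ≉ 1, so q ≥ 2.
lemma3p2 : ∀ {c ℓ : Level} (q : ℕ) → IsPrimePower q →
    (F : Field c ℓ) → FieldTheory.HasCardinality F q →
    (n : ℕ) (fs : List (FieldTheory.Poly F n)) →
    sum (map (FieldTheory.deg F) fs) < n →
    Σ (FieldTheory.Point F n) (FieldTheory.Z F fs) →
    ¬ FieldTheory.IsAffineSpace F (FieldTheory.Z F fs) →
    Σ (Fin (n + 2 ∸ sum (map (FieldTheory.deg F) fs)) → FieldTheory.Point F n) λ pts →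
      ((∀ i → FieldTheory.Z F fs (pts i)) × FieldTheory.GeneralPosition F pts)
lemma3p2 zero          _ F (_ , _ , onto) n fs _ _ _ with onto (Field.0# F)
... | () , _
lemma3p2 (suc zero)    _ F (_ , _ , onto) n fs _ _ _ with onto (Field.0# F) | onto (Field.1# F)
... | zero , e₀≈0 | zero , e₀≈1 = ⊥-elim (Field.0≉1 F (Field.trans F (Field.sym F e₀≈0) e₀≈1))
lemma3p2 (suc (suc q₀)) _ F card n fs d<n zero-exists not-affine =
  ZeroSetConstruction.general-position-zeros F q₀ card n fs d<n zero-exists not-affine
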